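{- Let $k\ge 3$ and let $G$ be a girth-regular graph of order $n$, valency $k$, even girth $g=2h$ and signature $\mathbf{a}=(a_1,\ldots,a_k)$. Then $$n\ge 2\frac{(k-1)^h-1}{k-2}+\max_{1\le i\le k}\left\lceil\frac{\left((k-1)^h-a_i\right)^2}{\sum_{j=1}^k a_j-3a_i+(k-1)^h-2\max\left(0,\left\lceil\frac{a_i^2}{2(k-1)^{h-1}}-\frac{a_i}{2}\right\rceil\right)}\right\rceil.$$
   Context: All graphs are simple, finite and connected, and valency $k>2$ is assumed throughout. For a $k$-regular graph of girth $g$, the signature of a vertex $v$ is the sequence $(a_1,\ldots,a_k)$, listed in non-decreasing order, of the numbers of $g$-cycles containing each of the $k$ edges incident with $v$; the graph is girth-regular if all vertices have the same signature, which is then called the signature of the graph. -}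

module Defs where

open import Data.Bool using (Bool; true; false; _∧_; not; if_then_else_)
open import Data.Nat as ℕ using (ℕ; zero; suc; _+_; _≤ᵇ_)
open import Data.Fin using (Fin; _≟_)
open import Data.List using (List; []; _∷_; _++_; [_]; length; filterᵇ; map)
open import Data.Bool.ListAction using (any)
open import Data.Nat.ListAction using (sum)
open import Data.Integer as ℤ using (ℤ)
open import Data.List.Relation.Binary.Permutation.Propositional using (_↭_)
open import Data.Vec as Vec using (Vec; toList; allFin)
open import Data.Rational as ℚ using (ℚ; 0ℚ)
import Data.Rational.Properties as ℚP
open import Relation.Nullary using (yes; no)
open import Relation.Nullary.Decidable using (⌊_⌋)
open import Relation.Binary.PropositionalEquality using (_≡_; _≢_)
open import Data.Product using (Σ; _×_)

record Graph (n : ℕ) : Set where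
  field
    adj    : Fin n → Fin n → Bool
    sym    : ∀ u v → adj u v ≡ adj v u
    irrefl : ∀ u → adj u u ≡ false
open Graph public

vertices : (n : ℕ) → List (Fin n)
vertices n = toList (allFin n)

neighbours : ∀ {n} → Graph n → Fin n → List (Fin n)
neighbours {n} G v = filterᵇ (adj G v) (vertices n)

degree : ∀ {n} → Graph n → Fin n → ℕ
degree G v = length (neighbours G v)

Regular : ∀ {n} → Graph n → ℕ → Set
Regular G k = ∀ v → degree G v ≡ k

data Reach {n} (G : Graph n) (u : Fin n) : Fin n → Set where
  here : Reach G u u
  step : ∀ {v w} → Reach G u v → adj G v w ≡ true → Reach G u w

Connected : ∀ {n} → Graph n → Set
Connected {n} G = ∀ (u v : Fin n) → Reach G u v

module _ {n : ℕ} (G : Graph n) where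

  consecAdj : List (Fin n) → Bool
  consecAdj (x ∷ y ∷ r) = adj G x y ∧ consecAdj (y ∷ r)
  consecAdj _           = true

  distinct : List (Fin n) → Bool
  distinct []      = true
  distinct (x ∷ r) = not (any (λ y → ⌊ x ≟ y ⌋) r) ∧ distinct r

  isCycle : List (Fin n) → Bool
  isCycle []        = false
  isCycle (x ∷ r)   = (3 ≤ᵇ length (x ∷ r)) ∧ distinct (x ∷ r) ∧ consecAdj ((x ∷ r) ++ [ x ])

  startsWith : Fin n → Fin n → List (Fin n) → Bool
  startsWith u v (x ∷ y ∷ _) = ⌊ u ≟ x ⌋ ∧ ⌊ v ≟ y ⌋
  startsWith u v _           = false

countVec : ∀ {n} (ℓ : ℕ) → (Vec (Fin n) ℓ → Bool) → ℕ
countVec zero    P = if P Vec.[] then 1 else 0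
countVec {n} (suc ℓ) P = sum (map (λ x → countVec ℓ (λ c → P (x Vec.∷ c))) (vertices n))

HasCycleOfLength : ∀ {n} → Graph n → ℕ → Set
HasCycleOfLength {n} G ℓ = Σ (Vec (Fin n) ℓ) (λ c → isCycle G (toList c) ≡ true)

HasGirth : ∀ {n} → Graph n → ℕ → Set
HasGirth G g = HasCycleOfLength G g × (∀ ℓ → ℓ ℕ.< g → ¬HC ℓ)
  where
    open import Relation.Nullary using (¬_)
    ¬HC : ℕ → Set
    ¬HC ℓ = ¬ HasCycleOfLength G ℓ

-- Number of ℓ-cycles (as subgraphs) containing the edge uv.  Each such
-- cycle has exactly one vertex listing (x₀,…,x_{ℓ-1}) with x₀ = u, x₁ = v.
cyclesThroughEdge : ∀ {n} → Graph n → ℕ → Fin n → Fin n → ℕ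
cyclesThroughEdge G ℓ u v =
  countVec ℓ (λ c → isCycle G (toList c) ∧ startsWith G u v (toList c))

edgeCycleCounts : ∀ {n} → Graph n → ℕ → Fin n → List ℕ
edgeCycleCounts G g v = map (cyclesThroughEdge G g v) (neighbours G v)

data NonDecreasing : List ℕ → Set where
  []  : NonDecreasing []
  [-] : ∀ x → NonDecreasing (x ∷ [])
  _∷_ : ∀ {x y r} → x ℕ.≤ y → NonDecreasing (y ∷ r) → NonDecreasing (x ∷ y ∷ r)

GirthRegularWithSignature : ∀ {n} → Graph n → (g k : ℕ) → Vec ℕ k → Set
GirthRegularWithSignature G g k a =
  NonDecreasing (toList a) × (∀ v → edgeCycleCounts G g v ↭ toList a)

ℕ→ℚ : ℕ → ℚ
ℕ→ℚ m = ℚ._/_ (ℤ.+ m) 1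

ℤ→ℚ : ℤ → ℚ
ℤ→ℚ z = ℚ._/_ z 1

-- division with the convention p / 0 = 0 (only relevant in the degenerate
-- 0/0 case of the bound)
_÷₀_ : ℚ → ℚ → ℚ
p ÷₀ q with q ℚP.≟ 0ℚ
... | yes _  = 0ℚ
... | no q≢0 = ℚ._÷_ p q {{ℚ.≢-nonZero q≢0}}

-- Fix an edge uv lying on aᵢ cycles of length g = 2h and count non-backtracking walks, i.e. entries of
-- powers of the non-backtracking matrix; below the girth such walks are determined by their end arcs.
-- Hence the vertices within distance h - 1 of the edge form a ball of exactly 2((k-1)^h - 1)/(k-2)
-- vertices, and of the K = (k-1)^h walks of length h leaving u away from v, aᵢ end in the ball (each
-- closes a g-cycle through uv) while the other P = K - aᵢ end at X new vertices. Cauchy–Schwarz gives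
-- P² ≤ X S, where S sums the squared numbers of walks ending at the new vertices. Counting the closed
-- non-backtracking walks v , u , … , u , v of length 2h + 2 in two ways yields S + (aᵢ + 2R) + 2aᵢ = K + Σ aⱼ,
-- where aᵢ + 2R is the same sum of squares over the ball; a second Cauchy–Schwarz over the (k-1)^(h-1)
-- ball vertices at level h - 1 gives aᵢ² ≤ (k-1)^(h-1) (aᵢ + 2R), i.e. M ≤ R. So D = S + 2(R - M) ≥ S,
-- and n ≥ |ball| + X ≥ |ball| + ⌈P² / D⌉.

module Submission where

open import Defs hiding (sym)
open import Data.Bool using (Bool; true; false; _∧_; _∨_; not; T?)
open import Data.Bool.ListAction using (any)
import Data.Bool.Properties as Boolₚ
open import Data.Nat as ℕ using (ℕ; zero; suc; _+_; _*_; _∸_; _^_; _≤_; _<_; z≤n; s≤s)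
open import Data.Nat.Properties hiding (_≟_)
import Data.Nat.Properties as ℕₚ
open import Data.Nat.Tactic.RingSolver using (solve-∀)
open import Data.Nat.Combinatorics using (_C_; nC1≡n; nCk+nC[k+1]≡[n+1]C[k+1])
open import Data.Nat.ListAction using (sum)
open import Data.Nat.ListAction.Properties using (sum-↭)
open import Data.Fin using (Fin; zero; suc; _≟_; toℕ; fromℕ)
import Data.Fin.Properties as Finₚ
open import Data.List using (List; []; _∷_; _++_; [_]; length; reverse; filterᵇ; map)
open import Data.List.Properties using (++-assoc; unfold-reverse; reverse-++; length-reverse; length-++)
open import Data.List.Membership.Propositional.Properties using (∈-map⁻; ∈-filter⁻)
open import Data.List.Relation.Binary.Permutation.Propositional using (_↭_; ↭-sym)
open import Data.List.Relation.Binary.Permutation.Propositional.Properties using (∈-resp-↭)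
open import Data.Vec as Vec using (Vec; lookup; toList; tabulate)
import Data.Vec.Properties as Vecₚ
open import Data.Vec.Membership.Propositional.Properties using (∈-lookup; ∈-toList⁺)
open import Data.Integer as ℤ using (ℤ)
import Data.Integer.Properties as ℤₚ
import Data.Integer.DivMod as ℤ
import Data.Integer.Tactic.RingSolver as ℤ-Solver
open import Data.Rational as ℚ using (ℚ; mkℚ; 0ℚ; ceiling; toℚᵘ)
import Data.Rational.Properties as ℚₚ
open import Data.Rational.Unnormalised as ℚᵘ using (mkℚᵘ)
import Data.Rational.Unnormalised.Properties as ℚᵘₚ
open import Data.Product using (Σ; _×_; _,_; proj₁; proj₂)
open import Data.Sum using (_⊎_; inj₁; inj₂; [_,_]′)
open import Data.Empty using (⊥; ⊥-elim)
open import Function using (_∘_; id; Equivalence)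
open import Relation.Nullary using (Dec; yes; no; ¬_)
open import Relation.Nullary.Decidable using (⌊_⌋)
open import Relation.Binary.PropositionalEquality hiding ([_])
import Algebra.Properties.Semiring.Sum +-*-semiring as Semiring

⟦_⟧ : Bool → ℕ
⟦ true ⟧ = 1
⟦ false ⟧ = 0

⟦∧⟧ : ∀ a b → ⟦ a ∧ b ⟧ ≡ ⟦ a ⟧ * ⟦ b ⟧
⟦∧⟧ false b = refl
⟦∧⟧ true b = sym (+-identityʳ _)

⟦⟧≤1 : ∀ b → ⟦ b ⟧ ≤ 1
⟦⟧≤1 true = ≤-refl
⟦⟧≤1 false = z≤n

⟦⟧-positive : ∀ {b} → 0 < ⟦ b ⟧ → b ≡ true
⟦⟧-positive {true} _ = refl

_==_ : ∀ {n} → Fin n → Fin n → Bool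
x == y = ⌊ x ≟ y ⌋

==-refl : ∀ {n} (x : Fin n) → (x == x) ≡ true
==-refl x with x ≟ x
... | yes _ = refl
... | no x≢x = ⊥-elim (x≢x refl)

==-≢ : ∀ {n} {x y : Fin n} → x ≢ y → (x == y) ≡ false
==-≢ {x = x} {y} x≢y with x ≟ y
... | yes x≡y = ⊥-elim (x≢y x≡y)
... | no _ = refl

==-sym : ∀ {n} (x y : Fin n) → (x == y) ≡ (y == x)
==-sym x y with x ≟ y | y ≟ x
... | yes _ | yes _ = refl
... | no _ | no _ = refl
... | yes x≡y | no y≢x = ⊥-elim (y≢x (sym x≡y))
... | no x≢y | yes y≡x = ⊥-elim (x≢y (sym y≡x))

δ : ∀ {n} → Fin n → Fin n → ℕ
δ i j = ⟦ i == j ⟧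

δ-refl : ∀ {n} (i : Fin n) → δ i i ≡ 1
δ-refl i = cong ⟦_⟧ (==-refl i)

δ-≢ : ∀ {n} {i j : Fin n} → i ≢ j → δ i j ≡ 0
δ-≢ i≢j = cong ⟦_⟧ (==-≢ i≢j)

δ-sym : ∀ {n} (i j : Fin n) → δ i j ≡ δ j i
δ-sym i j = cong ⟦_⟧ (==-sym i j)

δ≤1 : ∀ {n} (i j : Fin n) → δ i j ≤ 1
δ≤1 i j = ⟦⟧≤1 (i == j)

δ-positive : ∀ {n} {i j : Fin n} → 0 < δ i j → i ≡ j
δ-positive {i = i} {j} 0<δ with i ≟ j
... | yes i≡j = i≡j
... | no _ = ⊥-elim (<-irrefl refl 0<δ)

m*n>0⇒m>0×n>0 : ∀ m n → 0 < m * n → 0 < m × 0 < n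
m*n>0⇒m>0×n>0 (suc m) (suc n) _ = s≤s z≤n , s≤s z≤n
m*n>0⇒m>0×n>0 (suc m) zero 0<m*0 = ⊥-elim (<-irrefl (sym (*-zeroʳ m)) 0<m*0)

m+n>0⇒m>0⊎n>0 : ∀ m n → 0 < m + n → 0 < m ⊎ 0 < n
m+n>0⇒m>0⊎n>0 (suc m) n _ = inj₁ (s≤s z≤n)
m+n>0⇒m>0⊎n>0 zero n 0<n = inj₂ 0<n

*-cong-positiveˡ : ∀ m {a b} → (0 < m → a ≡ b) → m * a ≡ m * b
*-cong-positiveˡ zero _ = refl
*-cong-positiveˡ (suc m) a≡b = cong (suc m *_) (a≡b (s≤s z≤n))

*-cong-positiveʳ : ∀ m {a b} → (0 < m → a ≡ b) → a * m ≡ b * m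
*-cong-positiveʳ m {a} {b} a≡b = trans (*-comm a m) (trans (*-cong-positiveˡ m a≡b) (*-comm m b))

m*n≡m : ∀ m {n} → (0 < m → n ≡ 1) → m * n ≡ m
m*n≡m m n≡1 = trans (*-cong-positiveˡ m n≡1) (*-identityʳ m)

m+n≤1 : ∀ {m n} → m ≤ 1 → n ≤ 1 → (0 < m → 0 < n → ⊥) → m + n ≤ 1
m+n≤1 {zero} _ n≤1 _ = n≤1
m+n≤1 {suc zero} {zero} m≤1 _ _ = m≤1
m+n≤1 {suc zero} {suc n} _ _ both = ⊥-elim (both (s≤s z≤n) (s≤s z≤n))
m+n≤1 {suc (suc m)} (s≤s ())

m*m≡m : ∀ {m} → m ≤ 1 → m * m ≡ m
m*m≡m {zero} _ = refl
m*m≡m {suc zero} _ = refl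
m*m≡m {suc (suc m)} (s≤s ())

-- Opaque, so that unification treats ∑ as a rigid head and infers the summand.
opaque
  ∑ : ∀ {n} → (Fin n → ℕ) → ℕ
  ∑ = Semiring.sum

∑-syntax : ∀ n → (Fin n → ℕ) → ℕ
∑-syntax n = ∑ {n}

syntax ∑-syntax n (λ i → x) = ∑[ i < n ] x

opaque
  unfolding ∑

  ∑-cong : ∀ {n} {f g : Fin n → ℕ} → (∀ i → f i ≡ g i) → ∑[ i < n ] f i ≡ ∑[ i < n ] g i
  ∑-cong = Semiring.sum-cong-≗

  ∑-distrib-+ : ∀ {n} (f g : Fin n → ℕ) → ∑[ i < n ] (f i + g i) ≡ ∑[ i < n ] f i + ∑[ i < n ] g i
  ∑-distrib-+ = Semiring.∑-distrib-+

  ∑-comm : ∀ {m n} (f : Fin m → Fin n → ℕ) → ∑[ i < m ] ∑[ j < n ] f i j ≡ ∑[ j < n ] ∑[ i < m ] f i j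
  ∑-comm = Semiring.∑-comm

  *-distribˡ-∑ : ∀ {n} m (f : Fin n → ℕ) → m * ∑[ i < n ] f i ≡ ∑[ i < n ] (m * f i)
  *-distribˡ-∑ = Semiring.*-distribˡ-sum

  *-distribʳ-∑ : ∀ {n} m (f : Fin n → ℕ) → (∑[ i < n ] f i) * m ≡ ∑[ i < n ] (f i * m)
  *-distribʳ-∑ = Semiring.*-distribʳ-sum

  ∑-zero : ∀ {n} {f : Fin n → ℕ} → (∀ i → f i ≡ 0) → ∑[ i < n ] f i ≡ 0
  ∑-zero {n} f≡0 = trans (∑-cong f≡0) (Semiring.sum-replicate-zero n)

  ∑-suc : ∀ {n} (f : Fin (suc n) → ℕ) → ∑[ i < suc n ] f i ≡ f zero + ∑[ i < n ] f (suc i)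
  ∑-suc f = refl

  ∑-mono-≤ : ∀ {n} {f g : Fin n → ℕ} → (∀ i → f i ≤ g i) → ∑[ i < n ] f i ≤ ∑[ i < n ] g i
  ∑-mono-≤ {zero} _ = z≤n
  ∑-mono-≤ {suc n} f≤g = +-mono-≤ (f≤g zero) (∑-mono-≤ (f≤g ∘ suc))

  ∑-one : ∀ n → ∑[ i < n ] 1 ≡ n
  ∑-one zero = refl
  ∑-one (suc n) = cong suc (∑-one n)

  ∑-single : ∀ {n} (f : Fin n → ℕ) j → (∀ i → i ≢ j → f i ≡ 0) → ∑[ i < n ] f i ≡ f j
  ∑-single {suc n} f zero f≡0 = trans (cong (f zero +_) (∑-zero (λ i → f≡0 (suc i) λ ()))) (+-identityʳ _)
  ∑-single {suc n} f (suc j) f≡0 =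
    trans (cong (_+ ∑[ i < n ] f (suc i)) (f≡0 zero λ ()))
          (∑-single (λ i → f (suc i)) j λ i i≢j → f≡0 (suc i) (i≢j ∘ Finₚ.suc-injective))

  ∑-δ : ∀ {n} j (f : Fin n → ℕ) → ∑[ i < n ] (δ i j * f i) ≡ f j
  ∑-δ j f = trans (∑-single _ j λ i i≢j → cong (_* f i) (δ-≢ i≢j)) (trans (cong (_* f j) (δ-refl j)) (+-identityʳ (f j)))

  ∑-positive : ∀ {n} (f : Fin n → ℕ) → 0 < ∑[ i < n ] f i → Σ (Fin n) λ i → 0 < f i
  ∑-positive {suc n} f 0<∑ with f zero in eq
  ... | suc _ = zero , subst (0 <_) (sym eq) (s≤s z≤n)
  ... | zero with ∑-positive (λ i → f (suc i)) 0<∑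
  ...   | i , 0<fi = suc i , 0<fi

  ∑-≤1 : ∀ {n} (f : Fin n → ℕ) → (∀ i → f i ≤ 1) → (∀ i j → 0 < f i → 0 < f j → i ≡ j) → ∑[ i < n ] f i ≤ 1
  ∑-≤1 {zero} f _ _ = z≤n
  ∑-≤1 {suc n} f f≤1 unique with f zero ℕ.≟ 0
  ... | yes f₀≡0 = subst (λ m → m + ∑[ i < n ] f (suc i) ≤ 1) (sym f₀≡0)
    (∑-≤1 (λ i → f (suc i)) (λ i → f≤1 (suc i)) λ i j p q → Finₚ.suc-injective (unique (suc i) (suc j) p q))
  ... | no f₀≢0 = subst (_≤ 1) (sym (trans (cong (f zero +_) (∑-zero rest≡0)) (+-identityʳ _))) (f≤1 zero)
    where
    rest≡0 : ∀ i → f (suc i) ≡ 0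
    rest≡0 i = n≤0⇒n≡0 (≮⇒≥ λ 0<fᵢ → Finₚ.0≢1+n (unique zero (suc i) (n≢0⇒n>0 f₀≢0) 0<fᵢ))

∑*∑ : ∀ {n} (f g : Fin n → ℕ) → (∑[ i < n ] f i) * (∑[ j < n ] g j) ≡ ∑[ i < n ] ∑[ j < n ] (f i * g j)
∑*∑ f g = trans (*-distribʳ-∑ _ f) (∑-cong λ i → *-distribˡ-∑ (f i) g)

2mn≤m²+n² : ∀ m n → 2 * (m * n) ≤ m * m + n * n
2mn≤m²+n² m n = [ ordered , (λ n≤m → subst₂ _≤_ (cong (2 *_) (*-comm n m)) (+-comm (n * n) (m * m)) (ordered n≤m)) ]′
                  (≤-total m n)
  where
  ordered : ∀ {m n} → m ≤ n → 2 * (m * n) ≤ m * m + n * n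
  ordered {m} m≤n with d , refl ← m≤n⇒∃[o]m+o≡n m≤n = subst₂ _≤_ (lhs m d) (rhs m d) (m≤m+n _ (d * d))
    where
    lhs : ∀ m d → 2 * (m * m) + 2 * (m * d) ≡ 2 * (m * (m + d))
    lhs = solve-∀
    rhs : ∀ m d → 2 * (m * m) + 2 * (m * d) + d * d ≡ m * m + (m + d) * (m + d)
    rhs = solve-∀

-- Sum 2 (f i g j) (f j g i) ≤ (f i g j)² + (f j g i)² over all pairs (i , j).
cauchy-schwarz : ∀ {n} (f g : Fin n → ℕ) →
  (∑[ i < n ] (f i * g i)) * (∑[ i < n ] (f i * g i)) ≤ (∑[ i < n ] (f i * f i)) * (∑[ i < n ] (g i * g i))
cauchy-schwarz {n} f g = *-cancelˡ-≤ 2 (subst₂ _≤_ (sym 2S²) (sym 2AB) pairwise)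
  where
  open ≡-Reasoning
  pairwise : ∑[ i < n ] ∑[ j < n ] (2 * ((f i * g j) * (f j * g i)))
           ≤ ∑[ i < n ] ∑[ j < n ] ((f i * g j) * (f i * g j) + (f j * g i) * (f j * g i))
  pairwise = ∑-mono-≤ λ i → ∑-mono-≤ λ j → 2mn≤m²+n² (f i * g j) (f j * g i)
  swap : ∀ a b c d → (a * b) * (c * d) ≡ (a * d) * (c * b)
  swap = solve-∀
  square : ∀ a b → (a * b) * (a * b) ≡ (a * a) * (b * b)
  square = solve-∀
  S A B : ℕ
  S = ∑[ i < n ] (f i * g i)
  A = ∑[ i < n ] (f i * f i)
  B = ∑[ i < n ] (g i * g i)
  2S² : 2 * (S * S) ≡ ∑[ i < n ] ∑[ j < n ] (2 * ((f i * g j) * (f j * g i)))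
  2S² = begin
    2 * (S * S)
      ≡⟨ cong (2 *_) (∑*∑ (λ i → f i * g i) (λ j → f j * g j)) ⟩
    2 * ∑[ i < n ] ∑[ j < n ] ((f i * g i) * (f j * g j))
      ≡⟨ *-distribˡ-∑ 2 (λ i → ∑[ j < n ] ((f i * g i) * (f j * g j))) ⟩
    ∑[ i < n ] (2 * ∑[ j < n ] ((f i * g i) * (f j * g j)))
      ≡⟨ ∑-cong (λ i → *-distribˡ-∑ 2 (λ j → (f i * g i) * (f j * g j))) ⟩
    ∑[ i < n ] ∑[ j < n ] (2 * ((f i * g i) * (f j * g j)))
      ≡⟨ ∑-cong (λ i → ∑-cong λ j → cong (2 *_) (swap (f i) (g i) (f j) (g j))) ⟩
    ∑[ i < n ] ∑[ j < n ] (2 * ((f i * g j) * (f j * g i)))    ∎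
  2AB : 2 * (A * B) ≡ ∑[ i < n ] ∑[ j < n ] ((f i * g j) * (f i * g j) + (f j * g i) * (f j * g i))
  2AB = sym (begin
    ∑[ i < n ] ∑[ j < n ] ((f i * g j) * (f i * g j) + (f j * g i) * (f j * g i))
      ≡⟨ ∑-cong (λ i → ∑-distrib-+ (λ j → (f i * g j) * (f i * g j)) (λ j → (f j * g i) * (f j * g i))) ⟩
    ∑[ i < n ] (∑[ j < n ] ((f i * g j) * (f i * g j)) + ∑[ j < n ] ((f j * g i) * (f j * g i)))
      ≡⟨ ∑-distrib-+ (λ i → ∑[ j < n ] ((f i * g j) * (f i * g j)))
          (λ i → ∑[ j < n ] ((f j * g i) * (f j * g i))) ⟩
    ∑[ i < n ] ∑[ j < n ] ((f i * g j) * (f i * g j)) + ∑[ i < n ] ∑[ j < n ] ((f j * g i) * (f j * g i))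
      ≡⟨ cong₂ _+_ (∑-cong λ i → ∑-cong λ j → square (f i) (g j))
          (trans (∑-comm (λ i j → (f j * g i) * (f j * g i)))
              (∑-cong λ j → ∑-cong λ i → square (f j) (g i))) ⟩
    ∑[ i < n ] ∑[ j < n ] ((f i * f i) * (g j * g j)) + ∑[ j < n ] ∑[ i < n ] ((f j * f j) * (g i * g i))
      ≡⟨ cong₂ _+_ (sym (∑*∑ (λ i → f i * f i) (λ j → g j * g j)))
          (sym (∑*∑ (λ j → f j * f j) (λ i → g i * g i))) ⟩
    A * B + A * B
      ≡⟨ cong (A * B +_) (sym (+-identityʳ _)) ⟩
    2 * (A * B) ∎)

geometric-sum : ∀ d h → (∑[ j < h ] (suc d ^ toℕ j)) * d + 1 ≡ suc d ^ h
geometric-sum d zero = cong (λ s → s * d + 1) (∑-zero (λ ()))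
geometric-sum d (suc h) = begin
  (∑[ j < suc h ] (suc d ^ toℕ j)) * d + 1
    ≡⟨ cong (λ s → s * d + 1) (∑-suc (λ j → suc d ^ toℕ j)) ⟩
  (1 + ∑[ j < h ] (suc d * suc d ^ toℕ j)) * d + 1
    ≡⟨ cong (λ s → (1 + s) * d + 1) (sym (*-distribˡ-∑ (suc d) (λ j → suc d ^ toℕ j))) ⟩
  (1 + suc d * S) * d + 1
    ≡⟨ shift d S ⟩
  suc d * (S * d + 1)
    ≡⟨ cong (suc d *_) (geometric-sum d h) ⟩
  suc d * suc d ^ h ∎
  where
  open ≡-Reasoning
  S : ℕ
  S = ∑[ j < h ] (suc d ^ toℕ j)
  shift : ∀ d S → (1 + suc d * S) * d + 1 ≡ suc d * (S * d + 1)
  shift = solve-∀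

opaque
  unfolding ∑

  sum-map-vertices : ∀ {n} (f : Fin n → ℕ) → sum (map f (vertices n)) ≡ ∑[ i < n ] f i
  sum-map-vertices {n} f = go id
    where
    go : ∀ {m} (g : Fin m → Fin n) → sum (map f (toList (tabulate g))) ≡ ∑[ i < m ] f (g i)
    go {zero} g = refl
    go {suc m} g = cong (f (g zero) +_) (go (g ∘ suc))

  sum-map-filterᵇ-vertices : ∀ {n} (P : Fin n → Bool) (f : Fin n → ℕ) →
    sum (map f (filterᵇ P (vertices n))) ≡ ∑[ i < n ] (⟦ P i ⟧ * f i)
  sum-map-filterᵇ-vertices {n} P f = go id
    where
    go : ∀ {m} (g : Fin m → Fin n) → sum (map f (filterᵇ P (toList (tabulate g))))
        ≡ ∑[ i < m ] (⟦ P (g i) ⟧ * f (g i))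
    go {zero} g = refl
    go {suc m} g with P (g zero)
    ... | true = cong₂ _+_ (sym (+-identityʳ _)) (go (g ∘ suc))
    ... | false = go (g ∘ suc)

length-filterᵇ-vertices : ∀ {n} (P : Fin n → Bool) → length (filterᵇ P (vertices n)) ≡ ∑[ i < n ] ⟦ P i ⟧
length-filterᵇ-vertices {n} P = trans (length≡sum-map-1 (filterᵇ P (vertices n)))
    (trans (sum-map-filterᵇ-vertices P (λ _ → 1)) (∑-cong λ i → *-identityʳ ⟦ P i ⟧))
  where
  length≡sum-map-1 : ∀ {A : Set} (xs : List A) → length xs ≡ sum (map (λ _ → 1) xs)
  length≡sum-map-1 [] = refl
  length≡sum-map-1 (_ ∷ xs) = cong suc (length≡sum-map-1 xs)

-- Non-backtracking walks

∑∑-δδ : ∀ {n} (p x : Fin n) (f : Fin n → Fin n → ℕ) → ∑[ a < n ] ∑[ b < n ] ((δ p a * δ x b) * f a b) ≡ f p x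
∑∑-δδ {n} p x f = begin
  ∑[ a < n ] ∑[ b < n ] ((δ p a * δ x b) * f a b)  ≡⟨ ∑-cong (λ a → ∑-cong λ b → regroup a b) ⟩
  ∑[ a < n ] ∑[ b < n ] (δ b x * (δ a p * f a b))  ≡⟨ ∑-cong (λ a → ∑-δ x (λ b → δ a p * f a b)) ⟩
  ∑[ a < n ] (δ a p * f a x)                       ≡⟨ ∑-δ p (λ a → f a x) ⟩
  f p x                                            ∎
  where
  open ≡-Reasoning
  rearrange : ∀ s t c → (s * t) * c ≡ t * (s * c)
  rearrange = solve-∀
  regroup : ∀ a b → (δ p a * δ x b) * f a b ≡ δ b x * (δ a p * f a b)
  regroup a b = trans (rearrange (δ p a) (δ x b) (f a b))
      (cong₂ (λ s t → t * (s * f a b)) (δ-sym p a) (δ-sym x b))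

module NonBacktracking {n : ℕ} (G : Graph n) where

  nbStep? : Fin n → Fin n → Fin n → Bool
  nbStep? p x z = adj G p x ∧ adj G x z ∧ not (z == p)

  nbStep : Fin n → Fin n → Fin n → ℕ
  nbStep p x z = ⟦ nbStep? p x z ⟧

  -- Entries of the j-th power of the non-backtracking matrix, indexed by ordered pairs of
  -- vertices: for adjacent p , x, the number of non-backtracking walks p , x , … , q , y
  -- with j + 1 edges.
  nbWalks : ℕ → Fin n → Fin n → Fin n → Fin n → ℕ
  nbWalks zero p x q y = δ p q * δ x y
  nbWalks (suc j) p x q y = ∑[ z < n ] (nbStep p x z * nbWalks j x z q y)

  open ≡-Reasoning

  nbWalks-+ : ∀ i j p x q y → nbWalks (i + j) p x q y
      ≡ ∑[ a < n ] ∑[ b < n ] (nbWalks i p x a b * nbWalks j a b q y)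
  nbWalks-+ zero j p x q y = sym (∑∑-δδ p x (λ a b → nbWalks j a b q y))
  nbWalks-+ (suc i) j p x q y = begin
    ∑[ z < n ] (nbStep p x z * nbWalks (i + j) x z q y)
      ≡⟨ ∑-cong (λ z → cong (nbStep p x z *_) (nbWalks-+ i j x z q y)) ⟩
    ∑[ z < n ] (nbStep p x z * ∑[ a < n ] ∑[ b < n ] (nbWalks i x z a b * nbWalks j a b q y))
      ≡⟨ ∑-cong (λ z → trans (*-distribˡ-∑ (nbStep p x z) _) (∑-cong λ a → *-distribˡ-∑ (nbStep p x z) _)) ⟩
    ∑[ z < n ] ∑[ a < n ] ∑[ b < n ] (nbStep p x z * (nbWalks i x z a b * nbWalks j a b q y))
      ≡⟨ ∑-comm _ ⟩
    ∑[ a < n ] ∑[ z < n ] ∑[ b < n ] (nbStep p x z * (nbWalks i x z a b * nbWalks j a b q y))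
      ≡⟨ ∑-cong (λ a → ∑-comm _) ⟩
    ∑[ a < n ] ∑[ b < n ] ∑[ z < n ] (nbStep p x z * (nbWalks i x z a b * nbWalks j a b q y))
      ≡⟨ ∑-cong (λ a → ∑-cong λ b → trans (∑-cong λ z → sym (*-assoc (nbStep p x z) _ _))
          (sym (*-distribʳ-∑ (nbWalks j a b q y) _))) ⟩
    ∑[ a < n ] ∑[ b < n ] (nbWalks (suc i) p x a b * nbWalks j a b q y) ∎

  nbWalks-1 : ∀ a b q y → nbWalks 1 a b q y ≡ nbStep a b y * δ b q
  nbWalks-1 a b q y = begin
    ∑[ z < n ] (nbStep a b z * (δ b q * δ z y))  ≡⟨ ∑-cong (λ z → rotate (nbStep a b z) (δ b q) (δ z y)) ⟩
    ∑[ z < n ] (δ z y * (nbStep a b z * δ b q))  ≡⟨ ∑-δ y _ ⟩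
    nbStep a b y * δ b q                         ∎
    where
    rotate : ∀ s t c → s * (t * c) ≡ c * (s * t)
    rotate = solve-∀

  nbWalks-sucʳ : ∀ i p x q y → nbWalks (suc i) p x q y ≡ ∑[ a < n ] (nbWalks i p x a q * nbStep a q y)
  nbWalks-sucʳ i p x q y = begin
    nbWalks (suc i) p x q y
      ≡⟨ cong (λ m → nbWalks m p x q y) (+-comm 1 i) ⟩
    nbWalks (i + 1) p x q y
      ≡⟨ nbWalks-+ i 1 p x q y ⟩
    ∑[ a < n ] ∑[ b < n ] (nbWalks i p x a b * nbWalks 1 a b q y)
      ≡⟨ ∑-cong (λ a → ∑-cong λ b → trans (cong (nbWalks i p x a b *_) (nbWalks-1 a b q y))
          (sym (*-assoc (nbWalks i p x a b) _ _))) ⟩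
    ∑[ a < n ] ∑[ b < n ] ((nbWalks i p x a b * nbStep a b y) * δ b q)
      ≡⟨ ∑-cong (λ a → trans (∑-cong λ b → *-comm _ (δ b q))
          (∑-δ q (λ b → nbWalks i p x a b * nbStep a b y))) ⟩
    ∑[ a < n ] (nbWalks i p x a q * nbStep a q y) ∎

  nbStep-reverse : ∀ p x z → nbStep p x z ≡ nbStep z x p
  nbStep-reverse p x z rewrite Graph.sym G p x | Graph.sym G x z | ==-sym z p with adj G x p | adj G z x
  ... | true | true = refl
  ... | true | false = refl
  ... | false | true = refl
  ... | false | false = refl

  nbWalks-reverse : ∀ j p x q y → nbWalks j p x q y ≡ nbWalks j y q x p
  nbWalks-reverse zero p x q y = trans (*-comm (δ p q) _) (cong₂ _*_ (δ-sym x y) (δ-sym p q))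
  nbWalks-reverse (suc j) p x q y = begin
    ∑[ z < n ] (nbStep p x z * nbWalks j x z q y)
      ≡⟨ ∑-cong (λ z → trans (cong₂ _*_ (nbStep-reverse p x z) (nbWalks-reverse j x z q y))
          (*-comm (nbStep z x p) _)) ⟩
    ∑[ z < n ] (nbWalks j y q z x * nbStep z x p)
      ≡⟨ sym (nbWalks-sucʳ j y q x p) ⟩
    nbWalks (suc j) y q x p ∎

  nbStep?-true : ∀ {p x z} → nbStep? p x z ≡ true → adj G p x ≡ true × adj G x z ≡ true × (z == p) ≡ false
  nbStep?-true {p} {x} {z} s with adj G p x | adj G x z | z == p
  ... | true | true | false = refl , refl , refl

  nbStep≡1 : ∀ {p x z} → adj G p x ≡ true → adj G x z ≡ true → z ≢ p → nbStep p x z ≡ 1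
  nbStep≡1 {p} {x} {z} px xz z≢p rewrite px | xz | ==-≢ z≢p = refl

  nbStep-backtrack : ∀ p x → nbStep p x p ≡ 0
  nbStep-backtrack p x rewrite ==-refl p with adj G p x | adj G x p
  ... | true | true = refl
  ... | true | false = refl
  ... | false | _ = refl

  -- Of the k neighbours z of x exactly one, namely p, is excluded.
  ∑-nbStep : ∀ {k} → Regular G k → ∀ {p x} → adj G p x ≡ true → ∑[ z < n ] nbStep p x z ≡ k ∸ 1
  ∑-nbStep {k} regular {p} {x} px = begin
    ∑[ z < n ] nbStep p x z
      ≡⟨ ∑-cong (λ z → cong (λ b → ⟦ b ∧ adj G x z ∧ not (z == p) ⟧) px) ⟩
    S
      ≡⟨ sym (m+n∸n≡m S 1) ⟩
    S + 1 ∸ 1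
      ≡⟨ cong (λ m → S + m ∸ 1)
          (sym (trans (∑-δ p (λ z → ⟦ adj G x z ⟧)) (cong ⟦_⟧ (trans (Graph.sym G x p) px)))) ⟩
    S + ∑[ z < n ] (δ z p * ⟦ adj G x z ⟧) ∸ 1
      ≡⟨ cong (_∸ 1) (sym (∑-distrib-+ _ (λ z → δ z p * ⟦ adj G x z ⟧))) ⟩
    ∑[ z < n ] (⟦ adj G x z ∧ not (z == p) ⟧ + δ z p * ⟦ adj G x z ⟧) ∸ 1
      ≡⟨ cong (_∸ 1) (sym (∑-cong λ z → split (adj G x z) (z == p))) ⟩
    ∑[ z < n ] ⟦ adj G x z ⟧ ∸ 1
      ≡⟨ cong (_∸ 1) (trans (sym (length-filterᵇ-vertices (adj G x))) (regular x)) ⟩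
    k ∸ 1 ∎
    where
    S : ℕ
    S = ∑[ z < n ] ⟦ adj G x z ∧ not (z == p) ⟧
    split : ∀ a b → ⟦ a ⟧ ≡ ⟦ a ∧ not b ⟧ + ⟦ b ⟧ * ⟦ a ⟧
    split false false = refl
    split false true = refl
    split true false = refl
    split true true = refl

  ∑∑-nbWalks : ∀ {k} → Regular G k → ∀ j {p x} → adj G p x ≡ true → ∑[ q < n ] ∑[ y < n ] nbWalks j p x q y
      ≡ (k ∸ 1) ^ j
  ∑∑-nbWalks regular zero {p} {x} _ = trans (∑-cong λ q → ∑-cong λ y → sym (*-identityʳ _))
      (∑∑-δδ p x (λ _ _ → 1))
  ∑∑-nbWalks {k} regular (suc j) {p} {x} px = begin
    ∑[ q < n ] ∑[ y < n ] ∑[ z < n ] (nbStep p x z * nbWalks j x z q y)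
      ≡⟨ ∑-cong (λ q → ∑-comm _) ⟩
    ∑[ q < n ] ∑[ z < n ] ∑[ y < n ] (nbStep p x z * nbWalks j x z q y)
      ≡⟨ ∑-comm _ ⟩
    ∑[ z < n ] ∑[ q < n ] ∑[ y < n ] (nbStep p x z * nbWalks j x z q y)
      ≡⟨ ∑-cong (λ z → sym
          (trans (*-distribˡ-∑ (nbStep p x z) _) (∑-cong λ q → *-distribˡ-∑ (nbStep p x z) _))) ⟩
    ∑[ z < n ] (nbStep p x z * ∑[ q < n ] ∑[ y < n ] nbWalks j x z q y)
      ≡⟨ ∑-cong (λ z → *-cong-positiveˡ (nbStep p x z) λ 0<step →
                          ∑∑-nbWalks regular j (proj₁ (proj₂ (nbStep?-true (⟦⟧-positive 0<step))))) ⟩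
    ∑[ z < n ] (nbStep p x z * (k ∸ 1) ^ j)
      ≡⟨ sym (*-distribʳ-∑ ((k ∸ 1) ^ j) (nbStep p x)) ⟩
    (∑[ z < n ] nbStep p x z) * (k ∸ 1) ^ j
      ≡⟨ cong (_* (k ∸ 1) ^ j) (∑-nbStep regular px) ⟩
    (k ∸ 1) ^ suc j ∎

  nbWalksTo : ℕ → Fin n → Fin n → Fin n → ℕ
  nbWalksTo j p x y = ∑[ q < n ] nbWalks j p x q y

  ∑-nbWalksTo : ∀ {k} → Regular G k → ∀ j {p x} → adj G p x ≡ true → ∑[ y < n ] nbWalksTo j p x y
      ≡ (k ∸ 1) ^ j
  ∑-nbWalksTo regular j px = trans (∑-comm _) (∑∑-nbWalks regular j px)

  nbWalks-adjˡ : ∀ i {p x q y} → 0 < nbWalks (suc i) p x q y → adj G p x ≡ true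
  nbWalks-adjˡ i {p} {x} {q} {y} walks with z , 0<term ← ∑-positive
      (λ z → nbStep p x z * nbWalks i x z q y) walks =
    proj₁ (nbStep?-true (⟦⟧-positive (proj₁ (m*n>0⇒m>0×n>0 (nbStep p x z) (nbWalks i x z q y) 0<term))))

  nbWalks-adjʳ : ∀ i {p x q y} → 0 < nbWalks (suc i) p x q y → adj G q y ≡ true
  nbWalks-adjʳ i {p} {x} {q} {y} walks with a , 0<term ← ∑-positive (λ a → nbWalks i p x a q * nbStep a q y)
      (subst (0 <_) (nbWalks-sucʳ i p x q y) walks) =
    proj₁ (proj₂ (nbStep?-true
        (⟦⟧-positive (proj₂ (m*n>0⇒m>0×n>0 (nbWalks i p x a q) (nbStep a q y) 0<term)))))

∧-trueˡ : ∀ a {b} → a ∧ b ≡ true → a ≡ true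
∧-trueˡ true _ = refl

∧-trueʳ : ∀ a {b} → a ∧ b ≡ true → b ≡ true
∧-trueʳ true b≡true = b≡true

∧-true : ∀ {a b} → a ≡ true → b ≡ true → a ∧ b ≡ true
∧-true refl refl = refl

not-true : ∀ {a} → not a ≡ true → a ≡ false
not-true {false} _ = refl

≡true-ext : ∀ {a b} → (a ≡ true → b ≡ true) → (b ≡ true → a ≡ true) → a ≡ b
≡true-ext {true} a⇒b _ = sym (a⇒b refl)
≡true-ext {false} {false} _ _ = refl
≡true-ext {false} {true} _ b⇒a = b⇒a refl

false≢true : false ≢ true
false≢true ()

module Walks {n : ℕ} (G : Graph n) where
  open NonBacktracking G

  nbWalk? : Fin n → Fin n → List (Fin n) → Bool
  nbWalk? p x [] = true
  nbWalk? p x (z ∷ r) = nbStep? p x z ∧ nbWalk? x z r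

  lastArc : Fin n → Fin n → List (Fin n) → Fin n × Fin n
  lastArc p x [] = p , x
  lastArc p x (z ∷ r) = lastArc x z r

  lastOr : Fin n → List (Fin n) → Fin n
  lastOr d [] = d
  lastOr d (x ∷ r) = lastOr x r

  lastArc-last : ∀ p x r → proj₂ (lastArc p x r) ≡ lastOr x r
  lastArc-last p x [] = refl
  lastArc-last p x (z ∷ r) = lastArc-last x z r

  nbWalks-witness : ∀ j p x q y → 0 < nbWalks j p x q y →
    Σ (List (Fin n)) λ r → length r ≡ j × nbWalk? p x r ≡ true × lastArc p x r ≡ (q , y)
  nbWalks-witness zero p x q y 0<walks with m*n>0⇒m>0×n>0 (δ p q) (δ x y) 0<walks
  ... | 0<δpq , 0<δxy with δ-positive 0<δpq | δ-positive 0<δxy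
  ... | refl | refl = [] , refl , refl , refl
  nbWalks-witness (suc j) p x q y 0<walks with ∑-positive _ 0<walks
  ... | z , 0<term with m*n>0⇒m>0×n>0 (nbStep p x z) _ 0<term
  ... | 0<step , 0<rest with nbWalks-witness j x z q y 0<rest
  ... | r , |r| , walk , last = z ∷ r , cong suc |r| , ∧-true (⟦⟧-positive 0<step) walk , last

  noBacktrack? : List (Fin n) → Bool
  noBacktrack? (a ∷ b ∷ c ∷ r) = not (c == a) ∧ noBacktrack? (b ∷ c ∷ r)
  noBacktrack? _ = true

  -- nbWalk? follows the recursion of nbWalks; IsNBWalk is the symmetric description needed for reversal.
  IsNBWalk : List (Fin n) → Set
  IsNBWalk w = consecAdj G w ≡ true × noBacktrack? w ≡ true

  nbWalk?⇒IsNBWalk : ∀ {p x} r → adj G p x ≡ true → nbWalk? p x r ≡ true → IsNBWalk (p ∷ x ∷ r)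
  nbWalk?⇒IsNBWalk [] px _ = ∧-true px refl , refl
  nbWalk?⇒IsNBWalk {p} {x} (z ∷ r) px walk
    with _ , xz , z≢p ← nbStep?-true (∧-trueˡ (nbStep? p x z) walk)
    with adjs , noBack ← nbWalk?⇒IsNBWalk r xz (∧-trueʳ (nbStep? p x z) walk)
    = ∧-true px adjs , ∧-true (cong not z≢p) noBack

  IsNBWalk-tail : ∀ x r → IsNBWalk (x ∷ r) → IsNBWalk r
  IsNBWalk-tail x [] _ = refl , refl
  IsNBWalk-tail x (b ∷ []) _ = refl , refl
  IsNBWalk-tail x (b ∷ c ∷ r) (adjs , noBack) = ∧-trueʳ (adj G x b) adjs , ∧-trueʳ (not (c == x)) noBack

  consecAdj-++⁻ˡ : ∀ s t → consecAdj G (s ++ t) ≡ true → consecAdj G s ≡ true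
  consecAdj-++⁻ˡ [] t _ = refl
  consecAdj-++⁻ˡ (a ∷ []) t _ = refl
  consecAdj-++⁻ˡ (a ∷ b ∷ s) t adjs = ∧-true (∧-trueˡ (adj G a b) adjs)
      (consecAdj-++⁻ˡ (b ∷ s) t (∧-trueʳ (adj G a b) adjs))

  noBacktrack?-++⁻ˡ : ∀ s t → noBacktrack? (s ++ t) ≡ true → noBacktrack? s ≡ true
  noBacktrack?-++⁻ˡ [] t _ = refl
  noBacktrack?-++⁻ˡ (a ∷ []) t _ = refl
  noBacktrack?-++⁻ˡ (a ∷ b ∷ []) t _ = refl
  noBacktrack?-++⁻ˡ (a ∷ b ∷ c ∷ s) t noBack =
    ∧-true (∧-trueˡ (not (c == a)) noBack) (noBacktrack?-++⁻ˡ (b ∷ c ∷ s) t (∧-trueʳ (not (c == a)) noBack))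

  IsNBWalk-++⁻ˡ : ∀ s t → IsNBWalk (s ++ t) → IsNBWalk s
  IsNBWalk-++⁻ˡ s t (adjs , noBack) = consecAdj-++⁻ˡ s t adjs , noBacktrack?-++⁻ˡ s t noBack

  lastAdj : List (Fin n) → Fin n → Bool
  lastAdj [] x = true
  lastAdj (a ∷ []) x = adj G a x
  lastAdj (a ∷ b ∷ r) x = lastAdj (b ∷ r) x

  lastAdj-∷ʳ : ∀ w b x → lastAdj (w ++ [ b ]) x ≡ adj G b x
  lastAdj-∷ʳ [] b x = refl
  lastAdj-∷ʳ (a ∷ []) b x = refl
  lastAdj-∷ʳ (a ∷ c ∷ r) b x = lastAdj-∷ʳ (c ∷ r) b x

  consecAdj-∷ʳ⁺ : ∀ w x → consecAdj G w ≡ true → lastAdj w x ≡ true → consecAdj G (w ++ [ x ]) ≡ true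
  consecAdj-∷ʳ⁺ [] x _ _ = refl
  consecAdj-∷ʳ⁺ (a ∷ []) x _ ax = ∧-true ax refl
  consecAdj-∷ʳ⁺ (a ∷ b ∷ r) x adjs last =
    ∧-true (∧-trueˡ (adj G a b) adjs) (consecAdj-∷ʳ⁺ (b ∷ r) x (∧-trueʳ (adj G a b) adjs) last)

  consecAdj-reverse : ∀ w → consecAdj G w ≡ true → consecAdj G (reverse w) ≡ true
  consecAdj-reverse [] _ = refl
  consecAdj-reverse (a ∷ []) _ = refl
  consecAdj-reverse (a ∷ b ∷ r) adjs =
    subst (λ l → consecAdj G l ≡ true)
        (sym (trans (unfold-reverse a (b ∷ r)) (cong (_++ [ a ]) (unfold-reverse b r))))
      (consecAdj-∷ʳ⁺ (reverse r ++ [ b ]) a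
        (subst (λ l → consecAdj G l ≡ true) (unfold-reverse b r)
            (consecAdj-reverse (b ∷ r) (∧-trueʳ (adj G a b) adjs)))
        (trans (lastAdj-∷ʳ (reverse r) b a) (trans (Graph.sym G b a) (∧-trueˡ (adj G a b) adjs))))

  lastNoBacktrack? : List (Fin n) → Fin n → Bool
  lastNoBacktrack? (a ∷ b ∷ []) x = not (x == a)
  lastNoBacktrack? (a ∷ b ∷ c ∷ r) x = lastNoBacktrack? (b ∷ c ∷ r) x
  lastNoBacktrack? _ x = true

  lastNoBacktrack?-++ : ∀ w c b x → lastNoBacktrack? (w ++ c ∷ b ∷ []) x ≡ not (x == c)
  lastNoBacktrack?-++ [] c b x = refl
  lastNoBacktrack?-++ (a ∷ []) c b x = refl
  lastNoBacktrack?-++ (a ∷ d ∷ []) c b x = refl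
  lastNoBacktrack?-++ (a ∷ d ∷ f ∷ r) c b x = lastNoBacktrack?-++ (d ∷ f ∷ r) c b x

  noBacktrack?-∷ʳ⁺ : ∀ w x → noBacktrack? w ≡ true → lastNoBacktrack? w x ≡ true
      → noBacktrack? (w ++ [ x ]) ≡ true
  noBacktrack?-∷ʳ⁺ [] x _ _ = refl
  noBacktrack?-∷ʳ⁺ (a ∷ []) x _ _ = refl
  noBacktrack?-∷ʳ⁺ (a ∷ b ∷ []) x _ last = ∧-true last refl
  noBacktrack?-∷ʳ⁺ (a ∷ b ∷ c ∷ r) x noBack last =
    ∧-true (∧-trueˡ (not (c == a)) noBack)
        (noBacktrack?-∷ʳ⁺ (b ∷ c ∷ r) x (∧-trueʳ (not (c == a)) noBack) last)

  noBacktrack?-reverse : ∀ w → noBacktrack? w ≡ true → noBacktrack? (reverse w) ≡ true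
  noBacktrack?-reverse [] _ = refl
  noBacktrack?-reverse (a ∷ []) _ = refl
  noBacktrack?-reverse (a ∷ b ∷ []) _ = refl
  noBacktrack?-reverse (a ∷ b ∷ c ∷ r) noBack =
    subst (λ l → noBacktrack? l ≡ true) (sym (trans (unfold-reverse a (b ∷ c ∷ r)) (cong (_++ [ a ]) rev)))
      (noBacktrack?-∷ʳ⁺ (reverse r ++ c ∷ b ∷ []) a
        (subst (λ l → noBacktrack? l ≡ true) rev
            (noBacktrack?-reverse (b ∷ c ∷ r) (∧-trueʳ (not (c == a)) noBack)))
        (trans (lastNoBacktrack?-++ (reverse r) c b a)
            (trans (cong not (==-sym a c)) (∧-trueˡ (not (c == a)) noBack))))
    where
    rev : reverse (b ∷ c ∷ r) ≡ reverse r ++ c ∷ b ∷ []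
    rev = trans (unfold-reverse b (c ∷ r))
        (trans (cong (_++ [ b ]) (unfold-reverse c r)) (++-assoc (reverse r) [ c ] [ b ]))

  IsNBWalk-reverse : ∀ w → IsNBWalk w → IsNBWalk (reverse w)
  IsNBWalk-reverse w (adjs , noBack) = consecAdj-reverse w adjs , noBacktrack?-reverse w noBack

  consecAdj-join : ∀ s r t → consecAdj G (s ++ [ r ]) ≡ true → consecAdj G (r ∷ t) ≡ true
      → consecAdj G (s ++ r ∷ t) ≡ true
  consecAdj-join [] r t _ adjs = adjs
  consecAdj-join (d ∷ []) r t adjs₁ adjs₂ = ∧-true (∧-trueˡ (adj G d r) adjs₁) adjs₂
  consecAdj-join (d ∷ e ∷ s) r t adjs₁ adjs₂ =
    ∧-true (∧-trueˡ (adj G d e) adjs₁) (consecAdj-join (e ∷ s) r t (∧-trueʳ (adj G d e) adjs₁) adjs₂)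

  noBacktrack?-join : ∀ s a r b t → noBacktrack? (s ++ a ∷ r ∷ []) ≡ true → noBacktrack? (r ∷ b ∷ t) ≡ true →
    b ≢ a → noBacktrack? (s ++ a ∷ r ∷ b ∷ t) ≡ true
  noBacktrack?-join [] a r b t _ noBack b≢a = ∧-true (cong not (==-≢ b≢a)) noBack
  noBacktrack?-join (d ∷ []) a r b t noBack₁ noBack₂ b≢a =
    ∧-true (∧-trueˡ (not (r == d)) noBack₁) (noBacktrack?-join [] a r b t refl noBack₂ b≢a)
  noBacktrack?-join (d ∷ e ∷ []) a r b t noBack₁ noBack₂ b≢a =
    ∧-true (∧-trueˡ (not (a == d)) noBack₁)
        (noBacktrack?-join (e ∷ []) a r b t (∧-trueʳ (not (a == d)) noBack₁) noBack₂ b≢a)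
  noBacktrack?-join (d ∷ e ∷ f ∷ s) a r b t noBack₁ noBack₂ b≢a =
    ∧-true (∧-trueˡ (not (f == d)) noBack₁)
        (noBacktrack?-join (e ∷ f ∷ s) a r b t (∧-trueʳ (not (f == d)) noBack₁) noBack₂ b≢a)

  _∈?_ : Fin n → List (Fin n) → Bool
  x ∈? r = any (x ==_) r

  ∈?-++ : ∀ x s t → x ∈? (s ++ t) ≡ (x ∈? s) ∨ (x ∈? t)
  ∈?-++ x [] t = refl
  ∈?-++ x (y ∷ s) t rewrite ∈?-++ x s t = sym (Boolₚ.∨-assoc (x == y) (x ∈? s) (x ∈? t))

  distinct-++⁻ˡ : ∀ s t → distinct G (s ++ t) ≡ true → distinct G s ≡ true
  distinct-++⁻ˡ [] t _ = refl
  distinct-++⁻ˡ (x ∷ s) t dist =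
    ∧-true (not-∨⁻ˡ (trans (cong not (sym (∈?-++ x s t))) (∧-trueˡ (not (x ∈? (s ++ t))) dist)))
           (distinct-++⁻ˡ s t (∧-trueʳ (not (x ∈? (s ++ t))) dist))
    where
    not-∨⁻ˡ : ∀ {a b} → not (a ∨ b) ≡ true → not a ≡ true
    not-∨⁻ˡ {false} _ = refl

  distinct-closed : ∀ z m → distinct G (z ∷ m ++ [ z ]) ≡ false
  distinct-closed z m rewrite ∈?-++ z m [ z ] | ==-refl z | Boolₚ.∨-zeroʳ (z ∈? m) = refl

  split-at-first : ∀ x r → x ∈? r ≡ true →
    Σ (List (Fin n)) λ s → Σ (List (Fin n)) λ t → r ≡ s ++ x ∷ t × x ∈? s ≡ false
  split-at-first x (y ∷ r) x∈r with x ≟ y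
  ... | yes refl = [] , r , refl , refl
  ... | no x≢y with s , t , r≡ , x∉s ← split-at-first x r x∈r =
    y ∷ s , t , cong (y ∷_) r≡ , cong₂ _∨_ (==-≢ x≢y) x∉s

  lastOr-∷ʳ : ∀ b t → Σ (List (Fin n)) λ m → b ∷ t ≡ m ++ [ lastOr b t ]
  lastOr-∷ʳ b [] = [] , refl
  lastOr-∷ʳ b (c ∷ t) with m , eq ← lastOr-∷ʳ c t = b ∷ m , cong (b ∷_) eq

  reverse-head : ∀ a t → Σ (List (Fin n)) λ m → reverse (a ∷ t) ≡ lastOr a t ∷ m
  reverse-head a t with m , eq ← lastOr-∷ʳ a t =
    reverse m , trans (cong reverse eq) (reverse-++ m [ lastOr a t ])

  nbWalk?-∷ʳ : ∀ p x r y → nbWalk? p x (r ++ [ y ])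
      ≡ nbWalk? p x r ∧ nbStep? (proj₁ (lastArc p x r)) (proj₂ (lastArc p x r)) y
  nbWalk?-∷ʳ p x [] y = Boolₚ.∧-identityʳ _
  nbWalk?-∷ʳ p x (z ∷ r) y =
    trans (cong (nbStep? p x z ∧_) (nbWalk?-∷ʳ x z r y)) (sym (Boolₚ.∧-assoc (nbStep? p x z) _ _))

  lastArc-∷ʳ : ∀ p x r y → lastArc p x (r ++ [ y ]) ≡ (proj₂ (lastArc p x r) , y)
  lastArc-∷ʳ p x [] y = refl
  lastArc-∷ʳ p x (z ∷ r) y = lastArc-∷ʳ x z r y

  IsNBWalk⇒nbWalk? : ∀ p x r → IsNBWalk (p ∷ x ∷ r) → nbWalk? p x r ≡ true
  IsNBWalk⇒nbWalk? p x [] _ = refl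
  IsNBWalk⇒nbWalk? p x (z ∷ r) (adjs , noBack) =
    ∧-true (∧-true (∧-trueˡ (adj G p x) adjs) (∧-true (∧-trueˡ (adj G x z) adjs′) (∧-trueˡ (not (z == p)) noBack)))
           (IsNBWalk⇒nbWalk? x z r (adjs′ , ∧-trueʳ (not (z == p)) noBack))
    where
    adjs′ : consecAdj G (x ∷ z ∷ r) ≡ true
    adjs′ = ∧-trueʳ (adj G p x) adjs

  lastNoBacktrack?-lastArc : ∀ p x r y → lastNoBacktrack? (p ∷ x ∷ r) y ≡ not (y == proj₁ (lastArc p x r))
  lastNoBacktrack?-lastArc p x [] y = refl
  lastNoBacktrack?-lastArc p x (z ∷ r) y = lastNoBacktrack?-lastArc x z r y

  lastArc₁-∈ : ∀ p x r → proj₁ (lastArc p x r) ∈? (p ∷ x ∷ r) ≡ true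
  lastArc₁-∈ p x [] rewrite ==-refl p = refl
  lastArc₁-∈ p x (z ∷ r) rewrite lastArc₁-∈ x z r = Boolₚ.∨-zeroʳ _

  lastArc₂-∈ : ∀ p x r → proj₂ (lastArc p x r) ∈? (x ∷ r) ≡ true
  lastArc₂-∈ p x [] rewrite ==-refl x = refl
  lastArc₂-∈ p x (z ∷ r) rewrite lastArc₂-∈ x z r = Boolₚ.∨-zeroʳ _

  ∈?-∉?⇒≢ : ∀ {x y} r → y ∈? r ≡ true → x ∈? r ≡ false → (y == x) ≡ false
  ∈?-∉?⇒≢ {x} {y} r y∈r x∉r with y ≟ x
  ... | no _ = refl
  ... | yes refl = ⊥-elim (false≢true (trans (sym x∉r) y∈r))

  distinct⇒noBacktrack? : ∀ w → distinct G w ≡ true → noBacktrack? w ≡ true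
  distinct⇒noBacktrack? [] _ = refl
  distinct⇒noBacktrack? (a ∷ []) _ = refl
  distinct⇒noBacktrack? (a ∷ b ∷ []) _ = refl
  distinct⇒noBacktrack? (a ∷ b ∷ c ∷ r) dist =
    ∧-true (cong not (∈?-∉?⇒≢ (b ∷ c ∷ r) c∈ (not-true (∧-trueˡ (not (a ∈? (b ∷ c ∷ r))) dist))))
           (distinct⇒noBacktrack? (b ∷ c ∷ r) (∧-trueʳ (not (a ∈? (b ∷ c ∷ r))) dist))
    where
    c∈ : c ∈? (b ∷ c ∷ r) ≡ true
    c∈ rewrite ==-refl c = Boolₚ.∨-zeroʳ _

  isCycle-closed : ∀ x s → 2 ≤ length s → x ∈? s ≡ false → distinct G s ≡ true →
    consecAdj G ((x ∷ s) ++ [ x ]) ≡ true → isCycle G (x ∷ s) ≡ true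
  isCycle-closed x (y ∷ []) (s≤s ())
  isCycle-closed x (y ∷ y′ ∷ s) _ x∉s dist adjs =
    ∧-true {a = 3 ℕ.≤ᵇ length (x ∷ y ∷ y′ ∷ s)} refl (∧-true (∧-true (cong not x∉s) dist) adjs)

  module ShortWalks (g : ℕ) (noShortCycle : ∀ ℓ → ℓ < g → ¬ HasCycleOfLength G ℓ) where

    -- A vertex repeated on a non-backtracking walk closes a cycle no longer than the walk.
    short-nbWalk-distinct : ∀ w → IsNBWalk w → length w ≤ g → distinct G w ≡ true
    short-nbWalk-distinct [] _ _ = refl
    short-nbWalk-distinct (x ∷ r) walk |w|≤g with x ∈? r in x∈r
    ... | false = short-nbWalk-distinct r (IsNBWalk-tail x r walk) (≤-trans (n≤1+n _) |w|≤g)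
    ... | true with s , t , refl , x∉s ← split-at-first x r x∈r =
      ⊥-elim (closes s x∉s walk |w|≤g
        (short-nbWalk-distinct (s ++ x ∷ t) (IsNBWalk-tail x (s ++ x ∷ t) walk) (≤-trans (n≤1+n _) |w|≤g)))
      where
      closes : ∀ s → x ∈? s ≡ false → IsNBWalk (x ∷ s ++ x ∷ t) → length (x ∷ s ++ x ∷ t) ≤ g →
        distinct G (s ++ x ∷ t) ≡ true → ⊥
      closes [] _ (adjs , _) _ _ = Boolₚ.not-¬ (∧-trueˡ (adj G x x) adjs) (Graph.irrefl G x)
      closes (y ∷ []) _ (_ , noBack) _ _ =
        false≢true (trans (cong not (sym (==-refl x))) (∧-trueˡ (not (x == x)) noBack))
      closes s@(y ∷ y′ ∷ s′) x∉s (adjs , _) |w|≤g dist =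
        noShortCycle (length (x ∷ s)) |c|<g
          (Vec.fromList (x ∷ s) , subst (λ l → isCycle G l ≡ true) (sym (Vecₚ.toList∘fromList (x ∷ s))) cycle)
        where
        cycle : isCycle G (x ∷ s) ≡ true
        cycle = isCycle-closed x s (s≤s (s≤s z≤n)) x∉s (distinct-++⁻ˡ s (x ∷ t) dist)
                  (consecAdj-++⁻ˡ ((x ∷ s) ++ [ x ]) t
                      (subst (λ l → consecAdj G l ≡ true) (sym (++-assoc (x ∷ s) [ x ] t)) adjs))
        |c|<g : length (x ∷ s) < g
        |c|<g = ≤-trans (s≤s (subst (length s <_) (sym (length-++ s)) (m<m+n (length s) (s≤s z≤n)))) |w|≤g

    -- Two different such walks would combine into a closed non-backtracking walk of length < g.
    short-nbWalks-unique : ∀ r t₁ t₂ → IsNBWalk (r ∷ t₁) → IsNBWalk (r ∷ t₂) → lastOr r t₁ ≡ lastOr r t₂ →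
      suc (length t₁ + length t₂) ≤ g → t₁ ≡ t₂
    short-nbWalks-unique r [] [] _ _ _ _ = refl
    short-nbWalks-unique r [] (b ∷ t₂) _ walk₂ r≡last |ts|<g with m , eq ← lastOr-∷ʳ b t₂ =
      ⊥-elim (Boolₚ.not-¬
        (subst (λ l → distinct G (r ∷ l) ≡ true) eq (short-nbWalk-distinct (r ∷ b ∷ t₂) walk₂ |ts|<g))
        (subst (λ z → distinct G (r ∷ m ++ [ z ]) ≡ false) r≡last (distinct-closed r m)))
    short-nbWalks-unique r (a ∷ t₁) [] walk₁ _ last≡r |ts|<g with m , eq ← lastOr-∷ʳ a t₁ =
      ⊥-elim (Boolₚ.not-¬
        (subst (λ l → distinct G (r ∷ l) ≡ true) eq
          (short-nbWalk-distinct (r ∷ a ∷ t₁) walk₁ (subst (λ l → suc l ≤ g) (+-identityʳ _) |ts|<g)))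
        (subst (λ z → distinct G (r ∷ m ++ [ z ]) ≡ false) (sym last≡r) (distinct-closed r m)))
    short-nbWalks-unique r (a ∷ t₁) (b ∷ t₂) walk₁ walk₂ last≡last |ts|<g with a ≟ b
    ... | yes refl = cong (a ∷_)
      (short-nbWalks-unique a t₁ t₂ (IsNBWalk-tail r (a ∷ t₁) walk₁) (IsNBWalk-tail r (a ∷ t₂) walk₂) last≡last
        (≤-trans (s≤s (≤-trans (n≤1+n _) (≤-reflexive (sym (+-suc _ _))))) (≤-trans (n≤1+n _) |ts|<g)))
    ... | no a≢b = ⊥-elim (Boolₚ.not-¬
      (short-nbWalk-distinct W walk (subst (_≤ g) (sym |W|) |ts|<g))
      (subst (λ l → distinct G l ≡ false) (sym W-closed) (distinct-closed z (m₁ ++ r ∷ m₂))))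
      where
      W : List (Fin n)
      W = reverse t₁ ++ a ∷ r ∷ b ∷ t₂
      z : Fin n
      z = lastOr a t₁
      m₁ m₂ : List (Fin n)
      m₁ = proj₁ (reverse-head a t₁)
      m₂ = proj₁ (lastOr-∷ʳ b t₂)
      back : IsNBWalk (reverse t₁ ++ a ∷ r ∷ [])
      back = subst IsNBWalk
        (trans (unfold-reverse r (a ∷ t₁))
          (trans (cong (_++ [ r ]) (unfold-reverse a t₁)) (++-assoc (reverse t₁) [ a ] [ r ])))
        (IsNBWalk-reverse (r ∷ a ∷ t₁) walk₁)
      walk : IsNBWalk W
      walk =
        subst (λ l → consecAdj G l ≡ true) (++-assoc (reverse t₁) [ a ] (r ∷ b ∷ t₂))
          (consecAdj-join (reverse t₁ ++ [ a ]) r (b ∷ t₂)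
            (subst (λ l → consecAdj G l ≡ true) (sym (++-assoc (reverse t₁) [ a ] [ r ])) (proj₁ back))
            (proj₁ walk₂))
        , noBacktrack?-join (reverse t₁) a r b t₂ (proj₂ back) (proj₂ walk₂) (a≢b ∘ sym)
      |W| : length W ≡ suc (length (a ∷ t₁) + length (b ∷ t₂))
      |W| = trans (length-++ (reverse t₁)) (trans (cong (_+ length (a ∷ r ∷ b ∷ t₂)) (length-reverse t₁))
              (trans (+-suc (length t₁) _) (cong suc (+-suc (length t₁) _))))
      W-closed : W ≡ z ∷ (m₁ ++ r ∷ m₂) ++ [ z ]
      W-closed = begin
        reverse t₁ ++ a ∷ r ∷ b ∷ t₂
          ≡⟨ sym (++-assoc (reverse t₁) [ a ] (r ∷ b ∷ t₂)) ⟩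
        (reverse t₁ ++ [ a ]) ++ r ∷ b ∷ t₂
          ≡⟨ cong₂ (λ x y → x ++ r ∷ y) (trans (sym (unfold-reverse a t₁)) (proj₂ (reverse-head a t₁)))
                                        (proj₂ (lastOr-∷ʳ b t₂)) ⟩
        (z ∷ m₁) ++ r ∷ (m₂ ++ [ lastOr b t₂ ])
          ≡⟨ cong (λ y → z ∷ (m₁ ++ r ∷ (m₂ ++ [ y ]))) (sym last≡last) ⟩
        z ∷ (m₁ ++ r ∷ (m₂ ++ [ z ]))
          ≡⟨ cong (z ∷_) (sym (++-assoc m₁ (r ∷ m₂) [ z ])) ⟩
        z ∷ (m₁ ++ r ∷ m₂) ++ [ z ] ∎
        where open ≡-Reasoning

-- Below the girth, non-backtracking walks behave as in a tree: between two arcs there is at most one.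
module ShortNBWalkCounts {n : ℕ} (G : Graph n) (g : ℕ) (noShortCycle : ∀ ℓ → ℓ < g → ¬ HasCycleOfLength G ℓ) where
  open NonBacktracking G
  open Walks G
  open ShortWalks g noShortCycle

  lastArc-lastOr : ∀ {p x q y} r → lastArc p x r ≡ (q , y) → lastOr x r ≡ y
  lastArc-lastOr {p} {x} r last = trans (sym (lastArc-last p x r)) (cong proj₂ last)

  nbWalk?-adj : ∀ {p x z} r → nbWalk? p x (z ∷ r) ≡ true → adj G p x ≡ true
  nbWalk?-adj {p} {x} {z} r walk = proj₁ (nbStep?-true (∧-trueˡ (nbStep? p x z) walk))

  nbWalk?⇒IsNBWalk-tail : ∀ {a b} r → adj G a b ≡ true → nbWalk? a b r ≡ true → IsNBWalk (b ∷ r)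
  nbWalk?⇒IsNBWalk-tail {a} {b} r ab walk = IsNBWalk-tail a (b ∷ r) (nbWalk?⇒IsNBWalk r ab walk)

  nbWalks-end-unique : ∀ {a b} → adj G a b ≡ true → ∀ j j′ {p p′ x} →
    0 < nbWalks j a b p x → 0 < nbWalks j′ a b p′ x → suc (j + j′) ≤ g → j ≡ j′ × p ≡ p′
  nbWalks-end-unique {a} {b} ab j j′ {p} {p′} {x} walks walks′ j+j′<g
    with r , |r| , walk , last ← nbWalks-witness j a b p x walks
    with r′ , |r′| , walk′ , last′ ← nbWalks-witness j′ a b p′ x walks′
    with refl ← short-nbWalks-unique b r r′ (nbWalk?⇒IsNBWalk-tail r ab walk) (nbWalk?⇒IsNBWalk-tail r′ ab walk′)
                  (trans (lastArc-lastOr r last) (sym (lastArc-lastOr r′ last′)))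
                  (subst (λ m → suc m ≤ g) (sym (cong₂ _+_ |r| |r′|)) j+j′<g)
    = trans (sym |r|) |r′| , cong proj₁ (trans (sym last) last′)

  nbWalks-opposite-disjoint : ∀ {a b} → adj G a b ≡ true → ∀ j j′ {p p′ x} →
    0 < nbWalks j b a p x → 0 < nbWalks j′ a b p′ x → suc (suc (j + j′)) ≤ g → ⊥
  nbWalks-opposite-disjoint {a} {b} ab j j′ {p} {p′} {x} walks walks′ j+j′<g
    with r , |r| , walk , last ← nbWalks-witness j b a p x walks
    with r′ , |r′| , walk′ , last′ ← nbWalks-witness j′ a b p′ x walks′
    with short-nbWalks-unique b (a ∷ r) r′ (nbWalk?⇒IsNBWalk r (trans (Graph.sym G b a) ab) walk)
           (nbWalk?⇒IsNBWalk-tail r′ ab walk′) (trans (lastArc-lastOr r last) (sym (lastArc-lastOr r′ last′)))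
           (subst (λ m → suc (suc m) ≤ g) (sym (cong₂ _+_ |r| |r′|)) j+j′<g)
  ... | refl = false≢true (trans (cong not (sym (==-refl a)))
                                 (∧-trueˡ (not (a == a)) (proj₂ (nbWalk?⇒IsNBWalk (a ∷ r) ab walk′))))

  nbWalks≤1 : ∀ {a b} → adj G a b ≡ true → ∀ i {p x} → i + i ≤ suc g → nbWalks i a b p x ≤ 1
  nbWalks≤1 {a} {b} ab zero {p} {x} _ = *-mono-≤ (δ≤1 a p) (δ≤1 b x)
  nbWalks≤1 {a} {b} ab (suc i) {p} {x} 2i≤g+1 = subst (_≤ 1) (sym (nbWalks-sucʳ i a b p x))
    (∑-≤1 (λ c → nbWalks i a b c p * nbStep c p x)
      (λ c → *-mono-≤ (nbWalks≤1 ab i (≤-trans (n≤1+n _) (≤-trans 2i<g (n≤1+n _)))) (⟦⟧≤1 _))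
      (λ c c′ walks walks′ → proj₂ (nbWalks-end-unique ab i i (proj₁ (m*n>0⇒m>0×n>0 _ _ walks))
                                                              (proj₁ (m*n>0⇒m>0×n>0 _ _ walks′)) 2i<g)))
    where
    2i<g : suc (i + i) ≤ g
    2i<g = subst (_≤ g) (+-suc i i) (≤-pred 2i≤g+1)

  lastArc-split : ∀ {p x q y} z r → lastArc p x (z ∷ r) ≡ (q , y) →
    Σ (List (Fin n)) λ r₀ → z ∷ r ≡ r₀ ++ [ y ] × lastOr x r₀ ≡ q
  lastArc-split z [] refl = [] , refl , refl
  lastArc-split {p} {x} z (z′ ∷ r) last with r₀ , eq , last₀ ← lastArc-split {x} {z} z′ r last =
    z ∷ r₀ , cong (z ∷_) eq , last₀

  no-short-closed-nbWalk : ∀ j {a w} → suc (suc j) ≤ g → nbWalks (suc (suc j)) a w w a ≡ 0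
  no-short-closed-nbWalk j {a} {w} j+2≤g = n≤0⇒n≡0 (≮⇒≥ closed)
    where
    closed : ¬ 0 < nbWalks (suc (suc j)) a w w a
    closed walks
      with z ∷ r , |r| , walk , last ← nbWalks-witness (suc (suc j)) a w w a walks
      with r₀ , r≡ , w≡last ← lastArc-split {a} {w} z r last
      with refl ← short-nbWalks-unique w [] r₀ (refl , refl)
                    (IsNBWalk-++⁻ˡ (w ∷ r₀) [ a ] (nbWalk?⇒IsNBWalk-tail (r₀ ++ [ a ]) (nbWalk?-adj r walk)
                                                     (subst (λ l → nbWalk? a w l ≡ true) r≡ walk)))
                    (sym w≡last)
                    (≤-trans (≤-reflexive (cong suc (+-cancelʳ-≡ 1 (length r₀) (suc j)
                               (trans (sym (length-++ r₀)) (trans (cong length (sym r≡)) (trans |r| (+-comm 1 (suc j))))))))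
                             j+2≤g)
      = 0≢1+n (suc-injective (trans (sym (cong length r≡)) |r|))

  nbWalksTo-positive : ∀ j a b y → 0 < nbWalksTo j a b y → Σ (Fin n) λ q → 0 < nbWalks j a b q y
  nbWalksTo-positive j a b y = ∑-positive (λ q → nbWalks j a b q y)

  nbWalksTo-level-unique : ∀ {a b} → adj G a b ≡ true → ∀ j j′ {y} →
    0 < nbWalksTo j a b y → 0 < nbWalksTo j′ a b y → suc (j + j′) ≤ g → j ≡ j′
  nbWalksTo-level-unique {a} {b} ab j j′ {y} walks walks′ j+j′<g
    with q , walk ← nbWalksTo-positive j a b y walks | q′ , walk′ ← nbWalksTo-positive j′ a b y walks′ =
    proj₁ (nbWalks-end-unique ab j j′ walk walk′ j+j′<g)

  nbWalksTo-opposite-disjoint : ∀ {a b} → adj G a b ≡ true → ∀ j j′ {y} →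
    0 < nbWalksTo j b a y → 0 < nbWalksTo j′ a b y → suc (suc (j + j′)) ≤ g → ⊥
  nbWalksTo-opposite-disjoint {a} {b} ab j j′ {y} walks walks′ j+j′<g
    with q , walk ← nbWalksTo-positive j b a y walks | q′ , walk′ ← nbWalksTo-positive j′ a b y walks′ =
    nbWalks-opposite-disjoint ab j j′ walk walk′ j+j′<g

  nbWalksTo≤1 : ∀ {a b} → adj G a b ≡ true → ∀ j {y} → suc (j + j) ≤ g → nbWalksTo j a b y ≤ 1
  nbWalksTo≤1 ab j 2j<g = ∑-≤1 _ (λ q → nbWalks≤1 ab j (≤-trans (n≤1+n _) (≤-trans 2j<g (n≤1+n g))))
                                 (λ q q′ walk walk′ → proj₂ (nbWalks-end-unique ab j j walk walk′ 2j<g))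

-- Cycles through an edge

sumVec : ∀ {n} ℓ → (Vec (Fin n) ℓ → ℕ) → ℕ
sumVec zero f = f Vec.[]
sumVec {n} (suc ℓ) f = ∑[ x < n ] sumVec ℓ (λ c → f (x Vec.∷ c))

sumVec-cong : ∀ {n} ℓ {f f′ : Vec (Fin n) ℓ → ℕ} → (∀ c → f c ≡ f′ c) → sumVec ℓ f ≡ sumVec ℓ f′
sumVec-cong zero f≡f′ = f≡f′ Vec.[]
sumVec-cong (suc ℓ) f≡f′ = ∑-cong λ x → sumVec-cong ℓ λ c → f≡f′ (x Vec.∷ c)

*-distribˡ-sumVec : ∀ {n} ℓ m (f : Vec (Fin n) ℓ → ℕ) → m * sumVec ℓ f ≡ sumVec ℓ (λ c → m * f c)
*-distribˡ-sumVec zero m f = refl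
*-distribˡ-sumVec (suc ℓ) m f = trans (*-distribˡ-∑ m _)
    (∑-cong λ x → *-distribˡ-sumVec ℓ m (λ c → f (x Vec.∷ c)))

∑-sumVec-comm : ∀ {n} ℓ (f : Fin n → Vec (Fin n) ℓ → ℕ) → ∑[ a < n ] sumVec ℓ (f a)
    ≡ sumVec ℓ (λ c → ∑[ a < n ] f a c)
∑-sumVec-comm zero f = refl
∑-sumVec-comm (suc ℓ) f = trans (∑-comm _) (∑-cong λ x → ∑-sumVec-comm ℓ (λ a c → f a (x Vec.∷ c)))

countVec≡sumVec : ∀ {n} ℓ (P : Vec (Fin n) ℓ → Bool) → countVec ℓ P ≡ sumVec ℓ (λ c → ⟦ P c ⟧)
countVec≡sumVec zero P with P Vec.[]
... | true = refl
... | false = refl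
countVec≡sumVec (suc ℓ) P = trans (sum-map-vertices _) (∑-cong λ x → countVec≡sumVec ℓ (λ c → P (x Vec.∷ c)))

module ClosedWalks {n : ℕ} (G : Graph n) where
  open NonBacktracking G
  open Walks G
  open ≡-Reasoning

  arcδ : Fin n × Fin n → Fin n → Fin n → ℕ
  arcδ (a , b) q y = δ a q * δ b y

  nbWalks≡sumVec : ∀ j p x q y → nbWalks j p x q y
      ≡ sumVec j (λ c → ⟦ nbWalk? p x (toList c) ⟧ * arcδ (lastArc p x (toList c)) q y)
  nbWalks≡sumVec zero p x q y = sym (+-identityʳ _)
  nbWalks≡sumVec (suc j) p x q y = ∑-cong λ z → begin
    nbStep p x z * nbWalks j x z q y
      ≡⟨ cong (nbStep p x z *_) (nbWalks≡sumVec j x z q y) ⟩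
    nbStep p x z * sumVec j (λ c → ⟦ nbWalk? x z (toList c) ⟧ * arcδ (lastArc x z (toList c)) q y)
      ≡⟨ *-distribˡ-sumVec j (nbStep p x z) _ ⟩
    sumVec j (λ c → nbStep p x z * (⟦ nbWalk? x z (toList c) ⟧ * arcδ (lastArc x z (toList c)) q y))
      ≡⟨ sumVec-cong j
          (λ c → trans (sym (*-assoc (nbStep p x z) _ _)) (cong (_* _) (sym (⟦∧⟧ (nbStep? p x z) _)))) ⟩
    sumVec j (λ c → ⟦ nbStep? p x z ∧ nbWalk? x z (toList c) ⟧ * arcδ (lastArc x z (toList c)) q y) ∎

  nbWalks-2 : ∀ a b u w → nbWalks 2 a b u w ≡ nbStep a b u * nbStep b u w
  nbWalks-2 a b u w =
    trans (∑-cong λ z → trans (cong (nbStep a b z *_) (nbWalks-1 b z u w)) (rotate (nbStep a b z) (nbStep b z w) (δ z u)))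
          (∑-δ u (λ z → nbStep a b z * nbStep b z w))
    where
    rotate : ∀ s t c → s * (t * c) ≡ c * (s * t)
    rotate = solve-∀

  nbWalks-closing : ∀ m u w → nbWalks (m + 2) u w u w
      ≡ sumVec m (λ r → ⟦ nbWalk? u w (toList r ++ u ∷ w ∷ []) ⟧)
  nbWalks-closing m u w = begin
    nbWalks (m + 2) u w u w
      ≡⟨ nbWalks-+ m 2 u w u w ⟩
    ∑[ a < n ] ∑[ b < n ] (nbWalks m u w a b * nbWalks 2 a b u w)
      ≡⟨ ∑-cong (λ a → ∑-cong λ b → cong₂ _*_ (nbWalks≡sumVec m u w a b) (nbWalks-2 a b u w)) ⟩
    ∑[ a < n ] ∑[ b < n ] (sumVec m (walk a b) * (nbStep a b u * nbStep b u w))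
      ≡⟨ ∑-cong (λ a → ∑-cong λ b → trans (*-comm _ (nbStep a b u * nbStep b u w))
          (*-distribˡ-sumVec m (nbStep a b u * nbStep b u w) (walk a b))) ⟩
    ∑[ a < n ] ∑[ b < n ] sumVec m (λ r → (nbStep a b u * nbStep b u w) * walk a b r)
      ≡⟨ trans (∑-cong λ a → ∑-sumVec-comm m _) (∑-sumVec-comm m _) ⟩
    sumVec m (λ r → ∑[ a < n ] ∑[ b < n ] ((nbStep a b u * nbStep b u w) * walk a b r))
      ≡⟨ sumVec-cong m closing ⟩
    sumVec m (λ r → ⟦ nbWalk? u w (toList r ++ u ∷ w ∷ []) ⟧) ∎
    where
    walk : Fin n → Fin n → Vec (Fin n) m → ℕ
    walk a b r = ⟦ nbWalk? u w (toList r) ⟧ * arcδ (lastArc u w (toList r)) a b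
    closing : ∀ r → ∑[ a < n ] ∑[ b < n ] ((nbStep a b u * nbStep b u w) * walk a b r)
        ≡ ⟦ nbWalk? u w (toList r ++ u ∷ w ∷ []) ⟧
    closing r = begin
      ∑[ a < n ] ∑[ b < n ] ((nbStep a b u * nbStep b u w) * (⟦ nbWalk? u w ρ ⟧ * (δ ℓ₁ a * δ ℓ₂ b)))
        ≡⟨ ∑-cong (λ a → ∑-cong λ b → regroup (nbStep a b u * nbStep b u w) ⟦ nbWalk? u w ρ ⟧ (δ ℓ₁ a) (δ ℓ₂ b)) ⟩
      ∑[ a < n ] ∑[ b < n ] ((δ ℓ₁ a * δ ℓ₂ b) * (⟦ nbWalk? u w ρ ⟧ * (nbStep a b u * nbStep b u w)))
        ≡⟨ ∑∑-δδ ℓ₁ ℓ₂ (λ a b → ⟦ nbWalk? u w ρ ⟧ * (nbStep a b u * nbStep b u w)) ⟩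
      ⟦ nbWalk? u w ρ ⟧ * (nbStep ℓ₁ ℓ₂ u * nbStep ℓ₂ u w)
        ≡⟨ sym (trans (⟦∧⟧ (nbWalk? u w ρ ∧ nbStep? ℓ₁ ℓ₂ u) _)
            (trans (cong (_* nbStep ℓ₂ u w) (⟦∧⟧ (nbWalk? u w ρ) _)) (*-assoc ⟦ nbWalk? u w ρ ⟧ _ _))) ⟩
      ⟦ (nbWalk? u w ρ ∧ nbStep? ℓ₁ ℓ₂ u) ∧ nbStep? ℓ₂ u w ⟧
        ≡⟨ cong ⟦_⟧ (sym appended) ⟩
      ⟦ nbWalk? u w (ρ ++ u ∷ w ∷ []) ⟧ ∎
      where
      ρ : List (Fin n)
      ρ = toList r
      ℓ₁ ℓ₂ : Fin n
      ℓ₁ = proj₁ (lastArc u w ρ)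
      ℓ₂ = proj₂ (lastArc u w ρ)
      regroup : ∀ s t d₁ d₂ → s * (t * (d₁ * d₂)) ≡ (d₁ * d₂) * (t * s)
      regroup = solve-∀
      appended : nbWalk? u w (ρ ++ u ∷ w ∷ []) ≡ (nbWalk? u w ρ ∧ nbStep? ℓ₁ ℓ₂ u) ∧ nbStep? ℓ₂ u w
      appended = begin
        nbWalk? u w (ρ ++ u ∷ w ∷ [])
          ≡⟨ cong (nbWalk? u w) (sym (++-assoc ρ [ u ] [ w ])) ⟩
        nbWalk? u w ((ρ ++ [ u ]) ++ [ w ])
          ≡⟨ nbWalk?-∷ʳ u w (ρ ++ [ u ]) w ⟩
        nbWalk? u w (ρ ++ [ u ]) ∧ nbStep? (proj₁ (lastArc u w (ρ ++ [ u ]))) (proj₂ (lastArc u w (ρ ++ [ u ]))) w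
          ≡⟨ cong₂ (λ b arc → b ∧ nbStep? (proj₁ arc) (proj₂ arc) w) (nbWalk?-∷ʳ u w ρ u) (lastArc-∷ʳ u w ρ u) ⟩
        (nbWalk? u w ρ ∧ nbStep? ℓ₁ ℓ₂ u) ∧ nbStep? ℓ₂ u w ∎

  cyclesThroughEdge≡sumVec : ∀ m u w → cyclesThroughEdge G (suc (suc m)) u w
      ≡ sumVec m (λ r → ⟦ isCycle G (u ∷ w ∷ toList r) ⟧)
  cyclesThroughEdge≡sumVec m u w = begin
    cyclesThroughEdge G (suc (suc m)) u w
      ≡⟨ countVec≡sumVec (suc (suc m)) (λ c → isCycle G (toList c) ∧ startsWith G u w (toList c)) ⟩
    ∑[ a < n ] ∑[ b < n ] sumVec m (λ r → ⟦ isCycle G (a ∷ b ∷ toList r) ∧ ((u == a) ∧ (w == b)) ⟧)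
      ≡⟨ trans (∑-cong λ a → ∑-sumVec-comm m _) (∑-sumVec-comm m _) ⟩
    sumVec m (λ r → ∑[ a < n ] ∑[ b < n ] ⟦ isCycle G (a ∷ b ∷ toList r) ∧ ((u == a) ∧ (w == b)) ⟧)
      ≡⟨ sumVec-cong m
          (λ r → trans (∑-cong λ a → ∑-cong λ b → starts r a b)
              (∑∑-δδ u w (λ a b → ⟦ isCycle G (a ∷ b ∷ toList r) ⟧))) ⟩
    sumVec m (λ r → ⟦ isCycle G (u ∷ w ∷ toList r) ⟧) ∎
    where
    starts : ∀ r a b → ⟦ isCycle G (a ∷ b ∷ toList r) ∧ ((u == a) ∧ (w == b)) ⟧
        ≡ (δ u a * δ w b) * ⟦ isCycle G (a ∷ b ∷ toList r) ⟧
    starts r a b = trans (⟦∧⟧ (isCycle G (a ∷ b ∷ toList r)) _)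
        (trans (*-comm ⟦ isCycle G (a ∷ b ∷ toList r) ⟧ _)
            (cong (_* ⟦ isCycle G (a ∷ b ∷ toList r) ⟧) (⟦∧⟧ (u == a) (w == b))))

module ShortCycles {n : ℕ} (G : Graph n) (g : ℕ) (noShortCycle : ∀ ℓ → ℓ < g → ¬ HasCycleOfLength G ℓ) where
  open NonBacktracking G
  open Walks G
  open ShortWalks g noShortCycle
  open ShortNBWalkCounts G g noShortCycle using (nbWalk?-adj)
  open ClosedWalks G

  closing-nbWalk⇒isCycle : ∀ u w z r → suc (suc (length (z ∷ r))) ≤ g →
    nbWalk? u w (z ∷ r ++ u ∷ w ∷ []) ≡ true → isCycle G (u ∷ w ∷ z ∷ r) ≡ true
  closing-nbWalk⇒isCycle u w z r′ |L|≤g walk =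
    ∧-true {a = 3 ℕ.≤ᵇ length (u ∷ w ∷ r)} refl
      (∧-true (short-nbWalk-distinct (u ∷ w ∷ r) (IsNBWalk-++⁻ˡ (u ∷ w ∷ r) (u ∷ w ∷ []) closed) |L|≤g)
              (consecAdj-++⁻ˡ ((u ∷ w ∷ r) ++ [ u ]) [ w ]
                (subst (λ l → consecAdj G l ≡ true) (sym (++-assoc (u ∷ w ∷ r) [ u ] [ w ])) (proj₁ closed))))
    where
    r : List (Fin n)
    r = z ∷ r′
    closed : IsNBWalk (u ∷ w ∷ r ++ u ∷ w ∷ [])
    closed = nbWalk?⇒IsNBWalk (r ++ u ∷ w ∷ []) (nbWalk?-adj (r′ ++ u ∷ w ∷ []) walk) walk

  isCycle⇒closing-nbWalk : ∀ u w z r → isCycle G (u ∷ w ∷ z ∷ r) ≡ true → nbWalk? u w (z ∷ r ++ u ∷ w ∷ []) ≡ true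
  isCycle⇒closing-nbWalk u w z r cycle =
    subst (λ l → nbWalk? u w l ≡ true) (++-assoc (z ∷ r) [ u ] [ w ])
        (IsNBWalk⇒nbWalk? u w ((z ∷ r ++ [ u ]) ++ [ w ]) (adjs , noBack))
    where
    L : List (Fin n)
    L = u ∷ w ∷ z ∷ r
    dist : distinct G L ≡ true
    dist = ∧-trueˡ (distinct G L) cycle
    adjsL : consecAdj G (L ++ [ u ]) ≡ true
    adjsL = ∧-trueʳ (distinct G L) cycle
    adjs : consecAdj G ((L ++ [ u ]) ++ [ w ]) ≡ true
    adjs = consecAdj-∷ʳ⁺ (L ++ [ u ]) w adjsL (trans (lastAdj-∷ʳ L u w) (∧-trueˡ (adj G u w) adjsL))
    u∉ : u ∈? (w ∷ z ∷ r) ≡ false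
    u∉ = not-true (∧-trueˡ (not (u ∈? (w ∷ z ∷ r))) dist)
    w∉ : w ∈? (z ∷ r) ≡ false
    w∉ = not-true (∧-trueˡ (not (w ∈? (z ∷ r))) (∧-trueʳ (not (u ∈? (w ∷ z ∷ r))) dist))
    noBackL : noBacktrack? (L ++ [ u ]) ≡ true
    noBackL = noBacktrack?-∷ʳ⁺ L u (distinct⇒noBacktrack? L dist)
                (trans (lastNoBacktrack?-lastArc u w (z ∷ r) u)
                    (cong not (trans (==-sym u _) (∈?-∉?⇒≢ (w ∷ z ∷ r) (lastArc₁-∈ w z r) u∉))))
    noBack : noBacktrack? ((L ++ [ u ]) ++ [ w ]) ≡ true
    noBack = noBacktrack?-∷ʳ⁺ (L ++ [ u ]) w noBackL
               (trans (lastNoBacktrack?-lastArc u w (z ∷ r ++ [ u ]) w)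
                 (cong not (trans (cong (λ arc → w == proj₁ arc) (lastArc-∷ʳ u w (z ∷ r) u))
                     (trans (==-sym w _) (∈?-∉?⇒≢ (z ∷ r) (lastArc₂-∈ w z r) w∉)))))

  isCycle≡closing-nbWalk : ∀ u w z r → suc (suc (length (z ∷ r))) ≤ g →
    isCycle G (u ∷ w ∷ z ∷ r) ≡ nbWalk? u w (z ∷ r ++ u ∷ w ∷ [])
  isCycle≡closing-nbWalk u w z r |L|≤g =
    ≡true-ext (isCycle⇒closing-nbWalk u w z r) (closing-nbWalk⇒isCycle u w z r |L|≤g)

  cyclesThroughEdge≡nbWalks : ∀ ℓ u w → 3 ≤ ℓ → ℓ ≤ g → cyclesThroughEdge G ℓ u w ≡ nbWalks ℓ u w u w
  cyclesThroughEdge≡nbWalks (suc (suc zero)) u w (s≤s (s≤s ())) _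
  cyclesThroughEdge≡nbWalks (suc (suc (suc m))) u w _ m+3≤g = begin
    cyclesThroughEdge G (suc (suc (suc m))) u w
      ≡⟨ cyclesThroughEdge≡sumVec (suc m) u w ⟩
    sumVec (suc m) (λ r → ⟦ isCycle G (u ∷ w ∷ toList r) ⟧)
      ≡⟨ sumVec-cong (suc m) closes ⟩
    sumVec (suc m) (λ r → ⟦ nbWalk? u w (toList r ++ u ∷ w ∷ []) ⟧)
      ≡⟨ sym (nbWalks-closing (suc m) u w) ⟩
    nbWalks (suc m + 2) u w u w
      ≡⟨ cong (λ j → nbWalks j u w u w) (+-comm (suc m) 2) ⟩
    nbWalks (suc (suc (suc m))) u w u w ∎
    where
    open ≡-Reasoning
    closes : ∀ r → ⟦ isCycle G (u ∷ w ∷ toList r) ⟧ ≡ ⟦ nbWalk? u w (toList r ++ u ∷ w ∷ []) ⟧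
    closes (z Vec.∷ r) = cong ⟦_⟧
        (isCycle≡closing-nbWalk u w z (toList r)
            (subst (λ l → suc (suc (suc l)) ≤ g) (sym (Vecₚ.length-toList r)) m+3≤g))

square≡+2*C2 : ∀ t → t * t ≡ t + 2 * (t C 2)
square≡+2*C2 zero = refl
square≡+2*C2 (suc t) = begin
  suc t * suc t                ≡⟨ expand t ⟩
  t * t + (2 * t + 1)          ≡⟨ cong (_+ (2 * t + 1)) (square≡+2*C2 t) ⟩
  t + 2 * (t C 2) + (2 * t + 1) ≡⟨ regroup t (t C 2) ⟩
  suc t + 2 * (t + t C 2)      ≡⟨ cong (λ c → suc t + 2 * (c + t C 2)) (sym (nC1≡n t)) ⟩
  suc t + 2 * (t C 1 + t C 2)  ≡⟨ cong (λ c → suc t + 2 * c) (nCk+nC[k+1]≡[n+1]C[k+1] t 1) ⟩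
  suc t + 2 * (suc t C 2)      ∎
  where
  open ≡-Reasoning
  expand : ∀ t → suc t * suc t ≡ t * t + (2 * t + 1)
  expand = solve-∀
  regroup : ∀ t c → t + 2 * c + (2 * t + 1) ≡ suc t + 2 * (t + c)
  regroup = solve-∀

-- For a vertex with ball indicator b that ends t walks of length h from u: fresh b t = 1 iff it is a new
-- vertex (b = 0 < t), and freshWalks b t counts the walks ending there if it lies outside the ball.
fresh : ℕ → ℕ → ℕ
fresh zero zero = 0
fresh zero (suc _) = 1
fresh (suc _) _ = 0

freshWalks : ℕ → ℕ → ℕ
freshWalks zero t = t
freshWalks (suc _) t = 0

+fresh≤1 : ∀ {b} t → b ≤ 1 → b + fresh b t ≤ 1
+fresh≤1 {zero} zero _ = z≤n
+fresh≤1 {zero} (suc t) _ = ≤-refl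
+fresh≤1 {suc zero} t _ = ≤-refl
+fresh≤1 {suc (suc _)} t (s≤s ())

≡*+freshWalks : ∀ {b} t → b ≤ 1 → t ≡ b * t + freshWalks b t
≡*+freshWalks {zero} t _ = refl
≡*+freshWalks {suc zero} t _ = trans (sym (+-identityʳ t)) (cong (_+ 0) (sym (+-identityʳ t)))
≡*+freshWalks {suc (suc _)} t (s≤s ())

square≡*+freshWalks² : ∀ {b} t → b ≤ 1 → t * t ≡ b * (t * t) + freshWalks b t * freshWalks b t
square≡*+freshWalks² {zero} t _ = refl
square≡*+freshWalks² {suc zero} t _ = trans (sym (+-identityʳ (t * t)))
    (cong (_+ 0) (sym (+-identityʳ (t * t))))
square≡*+freshWalks² {suc (suc _)} t (s≤s ())

fresh*freshWalks : ∀ b t → fresh b t * freshWalks b t ≡ freshWalks b t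
fresh*freshWalks zero zero = refl
fresh*freshWalks zero (suc t) = +-identityʳ _
fresh*freshWalks (suc b) t = refl

fresh*fresh : ∀ b t → fresh b t * fresh b t ≡ fresh b t
fresh*fresh zero zero = refl
fresh*fresh zero (suc t) = refl
fresh*fresh (suc b) t = refl

-- In the notation of the proof idea: freshCount = X, walkCount = P, squareCount = S, pairCount = R.
record EdgeCountData (n k h a σ : ℕ) : Set where
  field
    freshCount walkCount squareCount pairCount : ℕ
    order : 2 * ∑[ j < h ] ((k ∸ 1) ^ toℕ j) + freshCount ≤ n
    walks-split : (k ∸ 1) ^ h ≡ a + walkCount
    walks-cauchy-schwarz : walkCount * walkCount ≤ freshCount * squareCount
    cycles-cauchy-schwarz : a * a ≤ (k ∸ 1) ^ (h ∸ 1) * (a + 2 * pairCount)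
    balance : squareCount + (a + 2 * pairCount) + (a + a) ≡ (k ∸ 1) ^ h + σ

module EdgeCounts {n : ℕ} (G : Graph n) {k : ℕ} (regular : Regular G k) (m : ℕ)
  (noShortCycle : ∀ ℓ → ℓ < suc (suc m) + suc (suc m) → ¬ HasCycleOfLength G ℓ)
  {u v : Fin n} (uv : adj G u v ≡ true) where

  open NonBacktracking G
  open ShortNBWalkCounts G (suc (suc m) + suc (suc m)) noShortCycle
  open ≡-Reasoning

  h : ℕ
  h = suc (suc m)

  vu : adj G v u ≡ true
  vu = trans (Graph.sym G v u) uv

  -- U j x (V j x): non-backtracking walks of length j from u (from v) to x whose first step is not along uv.
  U V : ℕ → Fin n → ℕ
  U j = nbWalksTo j v u
  V j = nbWalksTo j u v

  -- The indicator of the ball of radius h - 1 around the edge (see ball≤1).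
  ball : Fin n → ℕ
  ball x = ∑[ j < h ] (U (toℕ j) x + V (toℕ j) x)

  levels : ∀ {i j} → i < h → j < h → suc (suc (i + j)) ≤ h + h
  levels {i} i<h j<h = subst (_≤ h + h) (cong suc (+-suc i _)) (+-mono-≤ i<h j<h)

  U≤1 : ∀ j {x} → j < h → U j x ≤ 1
  U≤1 j j<h = nbWalksTo≤1 vu j (<⇒≤ (levels j<h j<h))

  V≤1 : ∀ j {x} → j < h → V j x ≤ 1
  V≤1 j j<h = nbWalksTo≤1 uv j (<⇒≤ (levels j<h j<h))

  U-V-disjoint : ∀ {i j x} → i < h → j < h → 0 < U i x → 0 < V j x → ⊥
  U-V-disjoint {i} {j} i<h j<h 0<U 0<V = nbWalksTo-opposite-disjoint uv i j 0<U 0<V (levels i<h j<h)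

  ball≤1 : ∀ x → ball x ≤ 1
  ball≤1 x = ∑-≤1 _
    (λ j → m+n≤1 (U≤1 (toℕ j) (Finₚ.toℕ<n j)) (V≤1 (toℕ j) (Finₚ.toℕ<n j)) (U-V-disjoint (Finₚ.toℕ<n j) (Finₚ.toℕ<n j)))
    (λ i j 0<ballᵢ 0<ballⱼ → Finₚ.toℕ-injective (same-level i j (m+n>0⇒m>0⊎n>0 _ _ 0<ballᵢ) (m+n>0⇒m>0⊎n>0 _ _ 0<ballⱼ)))
    where
    same-level : ∀ i j → 0 < U (toℕ i) x ⊎ 0 < V (toℕ i) x → 0 < U (toℕ j) x ⊎ 0 < V (toℕ j) x → toℕ i ≡ toℕ j
    same-level i j (inj₁ 0<U) (inj₁ 0<U′) = nbWalksTo-level-unique vu (toℕ i) (toℕ j) 0<U 0<U′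
        (<⇒≤ (levels (Finₚ.toℕ<n i) (Finₚ.toℕ<n j)))
    same-level i j (inj₂ 0<V) (inj₂ 0<V′) = nbWalksTo-level-unique uv (toℕ i) (toℕ j) 0<V 0<V′
        (<⇒≤ (levels (Finₚ.toℕ<n i) (Finₚ.toℕ<n j)))
    same-level i j (inj₁ 0<U) (inj₂ 0<V′) = ⊥-elim (U-V-disjoint (Finₚ.toℕ<n i) (Finₚ.toℕ<n j) 0<U 0<V′)
    same-level i j (inj₂ 0<V) (inj₁ 0<U′) = ⊥-elim (U-V-disjoint (Finₚ.toℕ<n j) (Finₚ.toℕ<n i) 0<U′ 0<V)

  ∑-ball : ∑[ x < n ] ball x ≡ ∑[ j < h ] ((k ∸ 1) ^ toℕ j + (k ∸ 1) ^ toℕ j)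
  ∑-ball = trans (∑-comm _) (∑-cong λ j →
    trans (∑-distrib-+ _ _) (cong₂ _+_ (∑-nbWalksTo regular (toℕ j) vu) (∑-nbWalksTo regular (toℕ j) uv)))

  -- A vertex reached at level h from u lies in the ball only at level h - 1 on the side of v.
  ball*U : ∀ x → ball x * U h x ≡ V (suc m) x * U h x
  ball*U x = *-cong-positiveʳ (U h x) λ 0<Uₕ → begin
    ball x                          ≡⟨ ∑-single _ (fromℕ (suc m)) (λ j j≢last → off-last j j≢last 0<Uₕ) ⟩
    U (toℕ (fromℕ (suc m))) x + V (toℕ (fromℕ (suc m))) x
                                    ≡⟨ cong (λ l → U l x + V l x) (Finₚ.toℕ-fromℕ (suc m)) ⟩
    U (suc m) x + V (suc m) x       ≡⟨ cong (_+ V (suc m) x) (below-h (suc m) ≤-refl 0<Uₕ) ⟩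
    V (suc m) x                     ∎
    where
    below-h : ∀ j → j < h → 0 < U h x → U j x ≡ 0
    below-h j j<h 0<Uₕ = n≤0⇒n≡0
        (≮⇒≥ λ 0<Uⱼ → <-irrefl (nbWalksTo-level-unique vu j h 0<Uⱼ 0<Uₕ (+-monoˡ-≤ h j<h)) j<h)
    off-last : ∀ j → j ≢ fromℕ (suc m) → 0 < U h x → U (toℕ j) x + V (toℕ j) x ≡ 0
    off-last j j≢last 0<Uₕ = cong₂ _+_ (below-h (toℕ j) (Finₚ.toℕ<n j) 0<Uₕ)
        (n≤0⇒n≡0 (≮⇒≥ λ 0<V → nbWalksTo-opposite-disjoint uv h (toℕ j) 0<Uₕ 0<V (far (toℕ j) below-last)))
      where
      below-last : toℕ j < suc m
      below-last = ≤∧≢⇒< (≤-pred (Finₚ.toℕ<n j)) λ j≡last → j≢last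
          (Finₚ.toℕ-injective (trans j≡last (sym (Finₚ.toℕ-fromℕ (suc m)))))
      far : ∀ t → t < suc m → suc (suc (h + t)) ≤ h + h
      far t t<m+1 = subst (_≤ h + h) (trans (+-suc h (suc t)) (cong suc (+-suc h t)))
          (+-monoʳ-≤ h (s≤s t<m+1))

  -- Arcs (p , x) reached at level h - 1 from the side of v and (q , x) at level h from the
  -- side of u join up into one non-backtracking walk.
  meeting-step : ∀ {p x q} → 0 < nbWalks (suc m) u v p x → 0 < nbWalks h v u q x → nbStep p x q ≡ 1
  meeting-step {p} {x} {q} walk walk′ = nbStep≡1 (nbWalks-adjʳ m walk)
      (trans (Graph.sym G x q) (nbWalks-adjʳ (suc m) walk′)) q≢p
    where
    -- Otherwise p would be reached from both sides of the edge by walks of total length 2h - 1.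
    q≢p : q ≢ p
    q≢p refl
      with a , 0<term ← ∑-positive (λ a → nbWalks m u v a p * nbStep a p x)
          (subst (0 <_) (nbWalks-sucʳ m u v p x) walk)
      with a′ , 0<term′ ← ∑-positive (λ a → nbWalks (suc m) v u a p * nbStep a p x)
          (subst (0 <_) (nbWalks-sucʳ (suc m) v u p x) walk′)
      = nbWalks-opposite-disjoint uv (suc m) m (proj₁ (m*n>0⇒m>0×n>0 (nbWalks (suc m) v u a′ p) _ 0<term′))
          (proj₁ (m*n>0⇒m>0×n>0 (nbWalks m u v a p) _ 0<term))
              (s≤s (s≤s (≤-trans (n≤1+n _)
                  (≤-reflexive (sym (trans (+-suc m (suc m)) (cong suc (+-suc m m))))))))

  ∑-V*U : ∑[ x < n ] (V (suc m) x * U h x) ≡ nbWalks (h + h) u v u v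
  ∑-V*U = begin
    ∑[ x < n ] (V (suc m) x * U h x)
      ≡⟨ ∑-cong (λ x → ∑*∑ (λ p → nbWalks (suc m) u v p x) (λ q → nbWalks h v u q x)) ⟩
    ∑[ x < n ] ∑[ p < n ] ∑[ q < n ] (nbWalks (suc m) u v p x * nbWalks h v u q x)
      ≡⟨ ∑-comm _ ⟩
    ∑[ p < n ] ∑[ x < n ] ∑[ q < n ] (nbWalks (suc m) u v p x * nbWalks h v u q x)
      ≡⟨ ∑-cong (λ p → ∑-cong λ x → ∑-cong λ q → joined p x q) ⟩
    ∑[ p < n ] ∑[ x < n ] ∑[ q < n ] (nbWalks (suc m) u v p x * (nbStep p x q * nbWalks h x q u v))
      ≡⟨ ∑-cong (λ p → ∑-cong λ x → sym (*-distribˡ-∑ (nbWalks (suc m) u v p x) _)) ⟩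
    ∑[ p < n ] ∑[ x < n ] (nbWalks (suc m) u v p x * nbWalks (suc h) p x u v)
      ≡⟨ sym (nbWalks-+ (suc m) (suc h) u v u v) ⟩
    nbWalks (suc m + suc h) u v u v
      ≡⟨ cong (λ j → nbWalks j u v u v) (cong suc (+-suc m (suc (suc m)))) ⟩
    nbWalks (h + h) u v u v ∎
    where
    joined : ∀ p x q → nbWalks (suc m) u v p x * nbWalks h v u q x
        ≡ nbWalks (suc m) u v p x * (nbStep p x q * nbWalks h x q u v)
    joined p x q = *-cong-positiveˡ (nbWalks (suc m) u v p x) λ walk → begin
      nbWalks h v u q x                    ≡⟨ sym (*-identityˡ _) ⟩
      1 * nbWalks h v u q x                ≡⟨ sym (*-cong-positiveʳ (nbWalks h v u q x) (meeting-step walk)) ⟩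
      nbStep p x q * nbWalks h v u q x     ≡⟨ cong (nbStep p x q *_) (nbWalks-reverse h v u q x) ⟩
      nbStep p x q * nbWalks h x q u v     ∎

  ℓ : ℕ
  ℓ = suc (suc (m + suc m))

  h+h≡1+ℓ : h + h ≡ suc ℓ
  h+h≡1+ℓ = cong (λ t → suc (suc t)) (+-suc m (suc m))

  closedWalks : Fin n → Fin n → ℕ
  closedWalks w w′ = nbWalks ℓ u w w′ u

  closedWalks-diagonal : ∀ w → closedWalks w w ≡ 0
  closedWalks-diagonal w = no-short-closed-nbWalk (m + suc m) {u} {w} (subst (ℓ ≤_) (sym h+h≡1+ℓ) (n≤1+n ℓ))

  closedWalks-adjˡ : ∀ {w w′} → 0 < closedWalks w w′ → adj G u w ≡ true
  closedWalks-adjˡ = nbWalks-adjˡ (suc (m + suc m))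

  closedWalks-adjʳ : ∀ {w w′} → 0 < closedWalks w w′ → adj G w′ u ≡ true
  closedWalks-adjʳ = nbWalks-adjʳ (suc (m + suc m))

  closedWalks-≢ : ∀ {w w′} → 0 < closedWalks w w′ → w ≢ w′
  closedWalks-≢ {w} 0<walks refl = <-irrefl (sym (closedWalks-diagonal w)) 0<walks

  nbWalks-h+h : ∀ w z → nbWalks (h + h) u w u z ≡ ∑[ w′ < n ] (closedWalks w w′ * nbStep w′ u z)
  nbWalks-h+h w z = trans (cong (λ j → nbWalks j u w u z) h+h≡1+ℓ) (nbWalks-sucʳ ℓ u w u z)

  a : ℕ
  a = nbWalks (h + h) u v u v

  signatureSum : ℕ
  signatureSum = ∑[ w < n ] (⟦ adj G u w ⟧ * nbWalks (h + h) u w u w)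

  signatureSum≡∑∑closedWalks : signatureSum ≡ ∑[ w < n ] ∑[ w′ < n ] closedWalks w w′
  signatureSum≡∑∑closedWalks = ∑-cong cycles-at
    where
    cycles-at : ∀ w → ⟦ adj G u w ⟧ * nbWalks (h + h) u w u w ≡ ∑[ w′ < n ] closedWalks w w′
    cycles-at w = begin
      ⟦ adj G u w ⟧ * nbWalks (h + h) u w u w
        ≡⟨ cong (⟦ adj G u w ⟧ *_) (nbWalks-h+h w w) ⟩
      ⟦ adj G u w ⟧ * ∑[ w′ < n ] (closedWalks w w′ * nbStep w′ u w)
        ≡⟨ *-distribˡ-∑ ⟦ adj G u w ⟧ _ ⟩
      ∑[ w′ < n ] (⟦ adj G u w ⟧ * (closedWalks w w′ * nbStep w′ u w))
        ≡⟨ ∑-cong (λ w′ → trans (swap ⟦ adj G u w ⟧ (closedWalks w w′) _) (closing w′)) ⟩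
      ∑[ w′ < n ] closedWalks w w′ ∎
      where
      swap : ∀ x y z → x * (y * z) ≡ y * (x * z)
      swap = solve-∀
      closing : ∀ w′ → closedWalks w w′ * (⟦ adj G u w ⟧ * nbStep w′ u w) ≡ closedWalks w w′
      closing w′ = m*n≡m (closedWalks w w′) λ 0<walks →
        cong₂ _*_ (cong ⟦_⟧ (closedWalks-adjˡ 0<walks))
                  (nbStep≡1 (closedWalks-adjʳ 0<walks) (closedWalks-adjˡ 0<walks) (closedWalks-≢ 0<walks))

  a≡∑closedWalks-from-v : a ≡ ∑[ w′ < n ] closedWalks v w′
  a≡∑closedWalks-from-v = trans (nbWalks-h+h v v) (∑-cong λ w′ → m*n≡m (closedWalks v w′) λ 0<walks →
    nbStep≡1 (closedWalks-adjʳ 0<walks) uv (closedWalks-≢ 0<walks))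

  ∑closedWalks-to-v≡a : ∑[ w < n ] closedWalks w v ≡ a
  ∑closedWalks-to-v≡a = trans (∑-cong λ w → nbWalks-reverse ℓ u w v u) (sym a≡∑closedWalks-from-v)

  nbWalks-2h+1 : nbWalks (suc (h + h)) v u u v
      ≡ ∑[ w < n ] ∑[ w′ < n ] (nbStep v u w * (closedWalks w w′ * nbStep w′ u v))
  nbWalks-2h+1 = ∑-cong λ w → trans (cong (nbStep v u w *_) (nbWalks-h+h w v)) (*-distribˡ-∑ (nbStep v u w) _)

  -- Split the closed walks according to whether they pass through v next to u.
  closedWalks-split : ∀ w w′ →
    nbStep v u w * (closedWalks w w′ * nbStep w′ u v) + δ w v * closedWalks w w′ + δ w′ v * closedWalks w w′
    ≡ closedWalks w w′
  closedWalks-split w w′ = by-cases (w ≟ v) (w′ ≟ v)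
    where
    swap : ∀ x y z → x * (y * z) ≡ y * (x * z)
    swap = solve-∀
    by-cases : Dec (w ≡ v) → Dec (w′ ≡ v) →
      nbStep v u w * (closedWalks w w′ * nbStep w′ u v) + δ w v * closedWalks w w′ + δ w′ v * closedWalks w w′
      ≡ closedWalks w w′
    by-cases (yes refl) (yes refl) rewrite closedWalks-diagonal v | nbStep-backtrack v u | δ-refl v = refl
    by-cases (yes refl) (no w′≢v) rewrite nbStep-backtrack v u | δ-refl v | δ-≢ w′≢v =
      trans (+-identityʳ _) (+-identityʳ _)
    by-cases (no w≢v) (yes refl)
      rewrite nbStep-backtrack v u | δ-refl v | δ-≢ w≢v | *-zeroʳ (closedWalks w v) | *-zeroʳ (nbStep v u w) =
      +-identityʳ _
    by-cases (no w≢v) (no w′≢v) rewrite δ-≢ w≢v | δ-≢ w′≢v =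
      trans (+-identityʳ _) (trans (+-identityʳ _) (trans (swap (nbStep v u w) (closedWalks w w′) _)
        (m*n≡m (closedWalks w w′) λ 0<walks →
          cong₂ _*_ (nbStep≡1 vu (closedWalks-adjˡ 0<walks) w≢v) (nbStep≡1 (closedWalks-adjʳ 0<walks) uv (w′≢v ∘ sym)))))

  signatureSum-split : signatureSum ≡ nbWalks (suc (h + h)) v u u v + a + a
  signatureSum-split = begin
    signatureSum
      ≡⟨ signatureSum≡∑∑closedWalks ⟩
    ∑[ w < n ] ∑[ w′ < n ] closedWalks w w′
      ≡⟨ ∑-cong (λ w → ∑-cong λ w′ → sym (closedWalks-split w w′)) ⟩
    ∑[ w < n ] ∑[ w′ < n ] (through-v w w′ + δ w v * closedWalks w w′ + δ w′ v * closedWalks w w′)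
      ≡⟨ ∑-cong (λ w → trans (∑-distrib-+ _ _)
          (cong (_+ ∑[ w′ < n ] (δ w′ v * closedWalks w w′)) (∑-distrib-+ _ _))) ⟩
    ∑[ w < n ] (∑[ w′ < n ] through-v w w′ + ∑[ w′ < n ] (δ w v * closedWalks w w′)
                 + ∑[ w′ < n ] (δ w′ v * closedWalks w w′))
      ≡⟨ trans (∑-distrib-+ _ _)
          (cong (_+ ∑[ w < n ] ∑[ w′ < n ] (δ w′ v * closedWalks w w′)) (∑-distrib-+ _ _)) ⟩
    ∑[ w < n ] ∑[ w′ < n ] through-v w w′ + ∑[ w < n ] ∑[ w′ < n ] (δ w v * closedWalks w w′)
      + ∑[ w < n ] ∑[ w′ < n ] (δ w′ v * closedWalks w w′)
      ≡⟨ cong₂ _+_ (cong₂ _+_ (sym nbWalks-2h+1) from-v) to-v ⟩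
    nbWalks (suc (h + h)) v u u v + a + a ∎
    where
    through-v : Fin n → Fin n → ℕ
    through-v w w′ = nbStep v u w * (closedWalks w w′ * nbStep w′ u v)
    from-v : ∑[ w < n ] ∑[ w′ < n ] (δ w v * closedWalks w w′) ≡ a
    from-v = trans (∑-cong λ w → sym (*-distribˡ-∑ (δ w v) (closedWalks w)))
        (trans (∑-δ v (λ w → ∑[ w′ < n ] closedWalks w w′)) (sym a≡∑closedWalks-from-v))
    to-v : ∑[ w < n ] ∑[ w′ < n ] (δ w′ v * closedWalks w w′) ≡ a
    to-v = trans (∑-cong λ w → ∑-δ v (closedWalks w)) ∑closedWalks-to-v≡a

  E : Fin n → Fin n → ℕ
  E p x = nbWalks h v u p x

  E≤1 : ∀ p x → E p x ≤ 1
  E≤1 p x = nbWalks≤1 vu h (n≤1+n (h + h))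

  -- Two arcs (p , x) ≠ (q , x) reached at level h from u combine into a walk through x.
  E*E : ∀ p q x → E p x * E q x ≡ δ p q * E p x + E p x * (nbStep p x q * E q x)
  E*E p q x with p ≟ q
  ... | yes refl rewrite nbStep-backtrack p x | *-zeroʳ (E p x) =
    trans (m*m≡m (E≤1 p x)) (sym (trans (+-identityʳ _) (+-identityʳ _)))
  ... | no p≢q = *-cong-positiveˡ (E p x) λ 0<Ep → sym (trans (*-comm _ (E q x)) (m*n≡m (E q x) λ 0<Eq →
    nbStep≡1 (nbWalks-adjʳ (suc m) 0<Ep) (trans (Graph.sym G x q) (nbWalks-adjʳ (suc m) 0<Eq)) (p≢q ∘ sym)))

  ∑-U² : ∑[ x < n ] (U h x * U h x) ≡ (k ∸ 1) ^ h + nbWalks (suc (h + h)) v u u v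
  ∑-U² = begin
    ∑[ x < n ] (U h x * U h x)
      ≡⟨ ∑-cong (λ x → ∑*∑ (λ p → E p x) (λ q → E q x)) ⟩
    ∑[ x < n ] ∑[ p < n ] ∑[ q < n ] (E p x * E q x)
      ≡⟨ ∑-cong (λ x → ∑-cong λ p → trans (∑-cong λ q → E*E p q x) (∑-distrib-+ _ _)) ⟩
    ∑[ x < n ] ∑[ p < n ] (∑[ q < n ] (δ p q * E p x) + ∑[ q < n ] (E p x * (nbStep p x q * E q x)))
      ≡⟨ ∑-cong (λ x → trans (∑-distrib-+ _ _)
          (cong (_+ ∑[ p < n ] ∑[ q < n ] (E p x * (nbStep p x q * E q x))) (∑-cong λ p → diagonal p x))) ⟩
    ∑[ x < n ] (U h x + ∑[ p < n ] ∑[ q < n ] (E p x * (nbStep p x q * E q x)))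
      ≡⟨ trans (∑-distrib-+ _ _) (cong₂ _+_ (∑-nbWalksTo regular h vu) (∑-comm _)) ⟩
    (k ∸ 1) ^ h + ∑[ p < n ] ∑[ x < n ] ∑[ q < n ] (E p x * (nbStep p x q * E q x))
      ≡⟨ cong ((k ∸ 1) ^ h +_)
          (∑-cong λ p → ∑-cong λ x → trans (sym (*-distribˡ-∑ (E p x) _))
              (cong (E p x *_) (∑-cong λ q → cong (nbStep p x q *_) (nbWalks-reverse h v u q x)))) ⟩
    (k ∸ 1) ^ h + ∑[ p < n ] ∑[ x < n ] (E p x * nbWalks (suc h) p x u v)
      ≡⟨ cong ((k ∸ 1) ^ h +_)
          (trans (sym (nbWalks-+ h (suc h) v u u v)) (cong (λ j → nbWalks j v u u v) (+-suc h h))) ⟩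
    (k ∸ 1) ^ h + nbWalks (suc (h + h)) v u u v ∎
    where
    diagonal : ∀ p x → ∑[ q < n ] (δ p q * E p x) ≡ E p x
    diagonal p x = trans (∑-cong λ q → cong (_* E p x) (δ-sym p q)) (trans (∑-δ p (λ _ → E p x)) refl)

  -- Both ∑ U² - (k - 1)^h and signatureSum - 2a count the closed walks v , u , … , u , v of length 2h + 2.
  ∑-U²+2a : ∑[ x < n ] (U h x * U h x) + (a + a) ≡ (k ∸ 1) ^ h + signatureSum
  ∑-U²+2a = begin
    ∑[ x < n ] (U h x * U h x) + (a + a)
      ≡⟨ cong (_+ (a + a)) ∑-U² ⟩
    (k ∸ 1) ^ h + nbWalks (suc (h + h)) v u u v + (a + a)
      ≡⟨ +-assoc ((k ∸ 1) ^ h) _ _ ⟩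
    (k ∸ 1) ^ h + (nbWalks (suc (h + h)) v u u v + (a + a))
      ≡⟨ cong ((k ∸ 1) ^ h +_) (trans (sym (+-assoc _ a a)) (sym signatureSum-split)) ⟩
    (k ∸ 1) ^ h + signatureSum ∎

  ∑-ball*U : ∑[ x < n ] (ball x * U h x) ≡ a
  ∑-ball*U = trans (∑-cong ball*U) ∑-V*U

  ∑-V*U² : ∑[ x < n ] (V (suc m) x * (U h x * U h x)) ≡ a + 2 * ∑[ x < n ] (V (suc m) x * (U h x C 2))
  ∑-V*U² = begin
    ∑[ x < n ] (V (suc m) x * (U h x * U h x))
      ≡⟨ ∑-cong (λ x → trans (cong (V (suc m) x *_) (square≡+2*C2 (U h x)))
          (distrib (V (suc m) x) (U h x) (U h x C 2))) ⟩
    ∑[ x < n ] (V (suc m) x * U h x + 2 * (V (suc m) x * (U h x C 2)))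
      ≡⟨ trans (∑-distrib-+ _ _) (cong₂ _+_ ∑-V*U (sym (*-distribˡ-∑ 2 _))) ⟩
    a + 2 * ∑[ x < n ] (V (suc m) x * (U h x C 2)) ∎
    where
    distrib : ∀ v t r → v * (t + 2 * r) ≡ v * t + 2 * (v * r)
    distrib = solve-∀

  freshCount walkCount squareCount pairCount : ℕ
  freshCount = ∑[ x < n ] fresh (ball x) (U h x)
  walkCount = ∑[ x < n ] freshWalks (ball x) (U h x)
  squareCount = ∑[ x < n ] (freshWalks (ball x) (U h x) * freshWalks (ball x) (U h x))
  pairCount = ∑[ x < n ] (V (suc m) x * (U h x C 2))

  ball+fresh≤n : 2 * ∑[ j < h ] ((k ∸ 1) ^ toℕ j) + freshCount ≤ n
  ball+fresh≤n = subst₂ _≤_ (cong (_+ freshCount) ∑-ball′) (∑-one n)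
                            (subst (_≤ ∑[ x < n ] 1) (∑-distrib-+ _ _) (∑-mono-≤ λ x → +fresh≤1 (U h x) (ball≤1 x)))
    where
    ∑-ball′ : ∑[ x < n ] ball x ≡ 2 * ∑[ j < h ] ((k ∸ 1) ^ toℕ j)
    ∑-ball′ = trans ∑-ball (trans (∑-distrib-+ (λ j → (k ∸ 1) ^ toℕ j) (λ j → (k ∸ 1) ^ toℕ j))
                                  (cong (∑[ j < h ] ((k ∸ 1) ^ toℕ j) +_) (sym (+-identityʳ _))))

  K≡a+walks : (k ∸ 1) ^ h ≡ a + walkCount
  K≡a+walks = begin
    (k ∸ 1) ^ h                                                ≡⟨ sym (∑-nbWalksTo regular h vu) ⟩
    ∑[ x < n ] U h x                                           ≡⟨ ∑-cong (λ x → ≡*+freshWalks (U h x) (ball≤1 x)) ⟩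
    ∑[ x < n ] (ball x * U h x + freshWalks (ball x) (U h x))  ≡⟨ trans (∑-distrib-+ _ _) (cong (_+ walkCount) ∑-ball*U) ⟩
    a + walkCount                                              ∎

  walks-cauchy-schwarz : walkCount * walkCount ≤ freshCount * squareCount
  walks-cauchy-schwarz = subst₂ _≤_ (cong (λ s → s * s) (∑-cong λ x → fresh*freshWalks (ball x) (U h x)))
                                    (cong (_* squareCount) (∑-cong λ x → fresh*fresh (ball x) (U h x)))
                                    (cauchy-schwarz (λ x → fresh (ball x) (U h x)) (λ x → freshWalks (ball x) (U h x)))

  cycles-cauchy-schwarz : a * a ≤ (k ∸ 1) ^ suc m * (a + 2 * pairCount)
  cycles-cauchy-schwarz = subst₂ _≤_
    (cong (λ s → s * s) (trans (∑-cong λ x → trans (sym (*-assoc (V (suc m) x) _ _)) (cong (_* U h x) (V²≡V x))) ∑-V*U))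
    (cong₂ _*_ (trans (∑-cong V²≡V) (∑-nbWalksTo regular (suc m) uv))
               (trans (∑-cong λ x → trans (square-product (V (suc m) x) (U h x)) (cong (_* (U h x * U h x)) (V²≡V x)))
                      ∑-V*U²))
    (cauchy-schwarz (V (suc m)) (λ x → V (suc m) x * U h x))
    where
    V²≡V : ∀ x → V (suc m) x * V (suc m) x ≡ V (suc m) x
    V²≡V x = m*m≡m (V≤1 (suc m) (s≤s ≤-refl))
    square-product : ∀ v t → (v * t) * (v * t) ≡ (v * v) * (t * t)
    square-product = solve-∀

  balance : squareCount + (a + 2 * pairCount) + (a + a) ≡ (k ∸ 1) ^ h + signatureSum
  balance = trans (cong (_+ (a + a)) (begin
    squareCount + (a + 2 * pairCount)                      ≡⟨ cong (squareCount +_) (sym ∑-V*U²) ⟩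
    squareCount + ∑[ x < n ] (V (suc m) x * (U h x * U h x)) ≡⟨ +-comm squareCount _ ⟩
    ∑[ x < n ] (V (suc m) x * (U h x * U h x)) + squareCount ≡⟨ sym ∑-U²-split ⟩
    ∑[ x < n ] (U h x * U h x)                              ∎)) ∑-U²+2a
    where
    ball*U² : ∀ x → ball x * (U h x * U h x) ≡ V (suc m) x * (U h x * U h x)
    ball*U² x = trans (sym (*-assoc (ball x) _ _))
        (trans (cong (_* U h x) (ball*U x)) (*-assoc (V (suc m) x) _ _))
    ∑-U²-split : ∑[ x < n ] (U h x * U h x) ≡ ∑[ x < n ] (V (suc m) x * (U h x * U h x)) + squareCount
    ∑-U²-split = trans (∑-cong λ x → square≡*+freshWalks² (U h x) (ball≤1 x))
        (trans (∑-distrib-+ _ _) (cong (_+ squareCount) (∑-cong ball*U²)))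

  edgeCountData : EdgeCountData n k h a signatureSum
  edgeCountData = record
    { freshCount = freshCount
    ; walkCount = walkCount
    ; squareCount = squareCount
    ; pairCount = pairCount
    ; order = ball+fresh≤n
    ; walks-split = K≡a+walks
    ; walks-cauchy-schwarz = walks-cauchy-schwarz
    ; cycles-cauchy-schwarz = cycles-cauchy-schwarz
    ; balance = balance
    }

-- The bound in ℚ

toℚᵘ-ℤ→ℚ : ∀ z → toℚᵘ (ℤ→ℚ z) ℚᵘ.≃ mkℚᵘ z 0
toℚᵘ-ℤ→ℚ z = ℚₚ.toℚᵘ-fromℚᵘ (mkℚᵘ z 0)

ℤ→ℚ-+ : ∀ x y → ℤ→ℚ (x ℤ.+ y) ≡ ℤ→ℚ x ℚ.+ ℤ→ℚ y
ℤ→ℚ-+ x y = ℚₚ.toℚᵘ-injective (begin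
  toℚᵘ (ℤ→ℚ (x ℤ.+ y))                ≈⟨ toℚᵘ-ℤ→ℚ (x ℤ.+ y) ⟩
  mkℚᵘ (x ℤ.+ y) 0                    ≈⟨ ℚᵘ.*≡* (identity x y) ⟨
  mkℚᵘ x 0 ℚᵘ.+ mkℚᵘ y 0              ≈⟨ ℚᵘₚ.+-cong (toℚᵘ-ℤ→ℚ x) (toℚᵘ-ℤ→ℚ y) ⟨
  toℚᵘ (ℤ→ℚ x) ℚᵘ.+ toℚᵘ (ℤ→ℚ y)      ≈⟨ ℚₚ.toℚᵘ-homo-+ (ℤ→ℚ x) (ℤ→ℚ y) ⟨
  toℚᵘ (ℤ→ℚ x ℚ.+ ℤ→ℚ y)              ∎)
  where
  open ℚᵘₚ.≃-Reasoning
  identity : ∀ x y → (x ℤ.* ℤ.+ 1 ℤ.+ y ℤ.* ℤ.+ 1) ℤ.* ℤ.+ 1 ≡ (x ℤ.+ y) ℤ.* ℤ.+ 1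
  identity = ℤ-Solver.solve-∀

ℤ→ℚ-* : ∀ x y → ℤ→ℚ (x ℤ.* y) ≡ ℤ→ℚ x ℚ.* ℤ→ℚ y
ℤ→ℚ-* x y = ℚₚ.toℚᵘ-injective (begin
  toℚᵘ (ℤ→ℚ (x ℤ.* y))                ≈⟨ toℚᵘ-ℤ→ℚ (x ℤ.* y) ⟩
  mkℚᵘ (x ℤ.* y) 0                    ≈⟨ ℚᵘₚ.*-cong (toℚᵘ-ℤ→ℚ x) (toℚᵘ-ℤ→ℚ y) ⟨
  toℚᵘ (ℤ→ℚ x) ℚᵘ.* toℚᵘ (ℤ→ℚ y)      ≈⟨ ℚₚ.toℚᵘ-homo-* (ℤ→ℚ x) (ℤ→ℚ y) ⟨
  toℚᵘ (ℤ→ℚ x ℚ.* ℤ→ℚ y)              ∎)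
  where open ℚᵘₚ.≃-Reasoning

ℤ→ℚ-neg : ∀ x → ℤ→ℚ (ℤ.- x) ≡ ℚ.- ℤ→ℚ x
ℤ→ℚ-neg x = ℚₚ.toℚᵘ-injective (begin
  toℚᵘ (ℤ→ℚ (ℤ.- x))      ≈⟨ toℚᵘ-ℤ→ℚ (ℤ.- x) ⟩
  mkℚᵘ (ℤ.- x) 0          ≈⟨ ℚᵘₚ.-‿cong (toℚᵘ-ℤ→ℚ x) ⟨
  ℚᵘ.- toℚᵘ (ℤ→ℚ x)       ≈⟨ ℚₚ.toℚᵘ-homo‿- (ℤ→ℚ x) ⟨
  toℚᵘ (ℚ.- ℤ→ℚ x)        ∎)
  where open ℚᵘₚ.≃-Reasoning

ℤ→ℚ-- : ∀ x y → ℤ→ℚ (x ℤ.- y) ≡ ℤ→ℚ x ℚ.- ℤ→ℚ y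
ℤ→ℚ-- x y = trans (ℤ→ℚ-+ x (ℤ.- y)) (cong (ℤ→ℚ x ℚ.+_) (ℤ→ℚ-neg y))

ℤ→ℚ-mono-≤ : ∀ {x y} → x ℤ.≤ y → ℤ→ℚ x ℚ.≤ ℤ→ℚ y
ℤ→ℚ-mono-≤ {x} {y} x≤y = ℚₚ.toℚᵘ-cancel-≤
  (ℚᵘₚ.≤-respʳ-≃ (ℚᵘₚ.≃-sym (toℚᵘ-ℤ→ℚ y)) (ℚᵘₚ.≤-respˡ-≃ (ℚᵘₚ.≃-sym (toℚᵘ-ℤ→ℚ x))
    (ℚᵘ.*≤* (subst₂ ℤ._≤_ (sym (ℤₚ.*-identityʳ x)) (sym (ℤₚ.*-identityʳ y)) x≤y))))

ℤ→ℚ-cancel-≤ : ∀ {x y} → ℤ→ℚ x ℚ.≤ ℤ→ℚ y → x ℤ.≤ y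
ℤ→ℚ-cancel-≤ {x} {y} x≤y
  with ℚᵘ.*≤* x*1≤y*1 ← ℚᵘₚ.≤-respʳ-≃ (toℚᵘ-ℤ→ℚ y) (ℚᵘₚ.≤-respˡ-≃ (toℚᵘ-ℤ→ℚ x) (ℚₚ.toℚᵘ-mono-≤ x≤y)) =
  subst₂ ℤ._≤_ (ℤₚ.*-identityʳ x) (ℤₚ.*-identityʳ y) x*1≤y*1

ℕ→ℚ-+ : ∀ m n → ℕ→ℚ (m ℕ.+ n) ≡ ℕ→ℚ m ℚ.+ ℕ→ℚ n
ℕ→ℚ-+ m n = trans (cong ℤ→ℚ (ℤₚ.pos-+ m n)) (ℤ→ℚ-+ (ℤ.+ m) (ℤ.+ n))

ℕ→ℚ-m+n-m : ∀ m n → ℕ→ℚ (m ℕ.+ n) ℚ.- ℕ→ℚ m ≡ ℕ→ℚ n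
ℕ→ℚ-m+n-m m n = trans (sym (ℤ→ℚ-- (ℤ.+ (m ℕ.+ n)) (ℤ.+ m)))
    (cong ℤ→ℚ (trans (cong (ℤ._- ℤ.+ m) (ℤₚ.pos-+ m n)) (cancel (ℤ.+ m) (ℤ.+ n))))
  where
  cancel : ∀ m n → m ℤ.+ n ℤ.- m ≡ n
  cancel = ℤ-Solver.solve-∀

ℕ→ℚ-* : ∀ m n → ℕ→ℚ (m ℕ.* n) ≡ ℕ→ℚ m ℚ.* ℕ→ℚ n
ℕ→ℚ-* m n = trans (cong ℤ→ℚ (ℤₚ.pos-* m n)) (ℤ→ℚ-* (ℤ.+ m) (ℤ.+ n))

ℕ→ℚ-mono-≤ : ∀ {m n} → m ℕ.≤ n → ℕ→ℚ m ℚ.≤ ℕ→ℚ n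
ℕ→ℚ-mono-≤ m≤n = ℤ→ℚ-mono-≤ (ℤ.+≤+ m≤n)

≤-floor : ∀ z s → ℤ→ℚ z ℚ.≤ s → z ℤ.≤ ℚ.floor s
≤-floor z s@(mkℚ p d-1 _) z≤s = subst (z ℤ.≤_) (sym (ℤ.div-pos-is-/ℕ p (suc d-1)))
  (ℤₚ.≮⇒≥ λ q<z → ℤₚ.<-irrefl refl (ℤₚ.<-≤-trans z<q+1 (ℤₚ.i<j⇒suc[i]≤j q<z)))
  where
  q : ℤ
  q = p ℤ./ℕ suc d-1
  z*d≤p : z ℤ.* ℤ.+ suc d-1 ℤ.≤ p
  z*d≤p with ℚᵘ.*≤* z*d≤p*1 ← ℚᵘₚ.≤-respˡ-≃ (toℚᵘ-ℤ→ℚ z) (ℚₚ.toℚᵘ-mono-≤ z≤s) =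
    subst (z ℤ.* ℤ.+ suc d-1 ℤ.≤_) (ℤₚ.*-identityʳ p) z*d≤p*1
  z<q+1 : z ℤ.< ℤ.suc q
  z<q+1 = ℤₚ.*-cancelʳ-<-nonNeg (ℤ.+ suc d-1) (ℤₚ.≤-<-trans z*d≤p (ℤ.n<s[n/ℕd]*d p (suc d-1)))

ceiling-≤ : ∀ r w → r ℚ.≤ ℤ→ℚ w → ceiling r ℤ.≤ w
ceiling-≤ r@(mkℚ _ _ _) w r≤w = subst (ℤ.- ℚ.floor (ℚ.- r) ℤ.≤_) (ℤₚ.neg-involutive w)
  (ℤₚ.neg-mono-≤ (≤-floor (ℤ.- w) (ℚ.- r) (subst (ℚ._≤ ℚ.- r) (sym (ℤ→ℚ-neg w)) (ℚₚ.neg-antimono-≤ r≤w))))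

÷₀≡÷ : ∀ p q (q≢0 : q ≢ 0ℚ) → p ÷₀ q ≡ ℚ._÷_ p q {{ℚ.≢-nonZero q≢0}}
÷₀≡÷ p q q≢0 with q ℚₚ.≟ 0ℚ
... | yes q≡0 = ⊥-elim (q≢0 q≡0)
... | no _ = refl

*-÷ : ∀ p q .{{_ : ℚ.NonZero q}} → (p ℚ.* q) ℚ.÷ q ≡ p
*-÷ p q = trans (ℚₚ.*-assoc p q (ℚ.1/ q)) (trans (cong (p ℚ.*_) (ℚₚ.*-inverseʳ q)) (ℚₚ.*-identityʳ p))

÷-≤ : ∀ p q r .{{_ : ℚ.NonZero q}} .{{_ : ℚ.Positive q}} → p ℚ.≤ r ℚ.* q → p ℚ.÷ q ℚ.≤ r
÷-≤ p q r p≤rq = ℚₚ.*-cancelʳ-≤-pos q (subst (ℚ._≤ r ℚ.* q) (sym ÷*≡) p≤rq)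
  where
  ÷*≡ : (p ℚ.÷ q) ℚ.* q ≡ p
  ÷*≡ = trans (ℚₚ.*-assoc p (ℚ.1/ q) q) (trans (cong (p ℚ.*_) (ℚₚ.*-inverseˡ q)) (ℚₚ.*-identityʳ p))

ℕ→ℚ-≢0 : ∀ m → 0 ℕ.< m → ℕ→ℚ m ≢ 0ℚ
ℕ→ℚ-≢0 (suc m) _ m≡0 with ℤ.+≤+ () ← ℤ→ℚ-cancel-≤ {ℤ.+ suc m} {ℤ.+ 0} (ℚₚ.≤-reflexive m≡0)

-- With the convention p ÷₀ 0 = 0 the bound also holds when D = 0, as then ceiling 0 = 0 ≤ w.
ceiling-÷₀-≤ : ∀ N D w → ℤ.0ℤ ℤ.≤ D → N ℤ.≤ w ℤ.* D → ℤ.0ℤ ℤ.≤ w → ceiling (ℤ→ℚ N ÷₀ ℤ→ℚ D) ℤ.≤ w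
ceiling-÷₀-≤ N D w 0≤D N≤wD 0≤w with ℤ→ℚ D ℚₚ.≟ 0ℚ
... | yes _ = 0≤w
... | no D≢0 = ceiling-≤ _ w
  (÷-≤ (ℤ→ℚ N) (ℤ→ℚ D) (ℤ→ℚ w) {{ℚ.≢-nonZero D≢0}} {{D>0}} (subst (ℤ→ℚ N ℚ.≤_) (ℤ→ℚ-* w D) (ℤ→ℚ-mono-≤ N≤wD)))
  where
  D>0 : ℚ.Positive (ℤ→ℚ D)
  D>0 = ℚₚ.nonNeg∧nonZero⇒pos (ℤ→ℚ D) {{ℚ.nonNegative (ℤ→ℚ-mono-≤ 0≤D)}} {{ℚ.≢-nonZero D≢0}}

moore-identity : ∀ d h → 2 ℕ.* ∑[ j < h ] (suc d ^ toℕ j) ℕ.* d ≡ 2 ℕ.* (suc d ^ h ∸ 1)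
moore-identity d h = begin
  2 ℕ.* S ℕ.* d          ≡⟨ ℕₚ.*-assoc 2 S d ⟩
  2 ℕ.* (S ℕ.* d)        ≡⟨ cong (2 ℕ.*_) (sym (ℕₚ.m+n∸n≡m (S ℕ.* d) 1)) ⟩
  2 ℕ.* (S ℕ.* d ℕ.+ 1 ∸ 1) ≡⟨ cong (λ t → 2 ℕ.* (t ∸ 1)) (geometric-sum d h) ⟩
  2 ℕ.* (suc d ^ h ∸ 1)  ∎
  where
  open ≡-Reasoning
  S : ℕ
  S = ∑[ j < h ] (suc d ^ toℕ j)

moore-term : ∀ k K T → 3 ℕ.≤ k → T ℕ.* (k ∸ 2) ≡ 2 ℕ.* (K ∸ 1) → ℕ→ℚ (2 ℕ.* (K ∸ 1)) ÷₀ ℕ→ℚ (k ∸ 2) ≡ ℕ→ℚ T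
moore-term k K T 3≤k T*[k-2] = begin
  ℕ→ℚ (2 ℕ.* (K ∸ 1)) ÷₀ ℕ→ℚ (k ∸ 2)
    ≡⟨ ÷₀≡÷ _ _ k-2≢0 ⟩
  ℕ→ℚ (2 ℕ.* (K ∸ 1)) ℚ.÷ ℕ→ℚ (k ∸ 2)
    ≡⟨ cong (ℚ._÷ ℕ→ℚ (k ∸ 2)) (trans (cong ℕ→ℚ (sym T*[k-2])) (ℕ→ℚ-* T (k ∸ 2))) ⟩
  (ℕ→ℚ T ℚ.* ℕ→ℚ (k ∸ 2)) ℚ.÷ ℕ→ℚ (k ∸ 2)
    ≡⟨ *-÷ (ℕ→ℚ T) (ℕ→ℚ (k ∸ 2)) ⟩
  ℕ→ℚ T ∎
  where
  open ≡-Reasoning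
  k-2≢0 : ℕ→ℚ (k ∸ 2) ≢ 0ℚ
  k-2≢0 = ℕ→ℚ-≢0 (k ∸ 2) (ℕₚ.∸-monoˡ-≤ 2 3≤k)
  instance
    k-2-nonZero : ℚ.NonZero (ℕ→ℚ (k ∸ 2))
    k-2-nonZero = ℚ.≢-nonZero k-2≢0

-- M, D and N of the statement, as functions of k, h, aᵢ and σ = Σ aⱼ.
correction : ℕ → ℕ → ℤ
correction a K′ = ℤ.0ℤ ℤ.⊔ ceiling ((ℕ→ℚ (a ^ 2) ÷₀ ℕ→ℚ (2 ℕ.* K′)) ℚ.- (ℚ._/_ (ℤ.+ a) 2))

denominator : ℕ → ℕ → ℕ → ℕ → ℚ
denominator k h a σ = ℕ→ℚ σ ℚ.- ℕ→ℚ (3 ℕ.* a) ℚ.+ ℕ→ℚ ((k ∸ 1) ^ h) ℚ.- ℤ→ℚ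
    (ℤ.+ 2 ℤ.* correction a ((k ∸ 1) ^ (h ∸ 1)))

numerator : ℕ → ℕ → ℕ → ℚ
numerator k h a = (ℕ→ℚ ((k ∸ 1) ^ h) ℚ.- ℕ→ℚ a) ℚ.* (ℕ→ℚ ((k ∸ 1) ^ h) ℚ.- ℕ→ℚ a)

-- a² / 2K′ - a / 2 ≤ R  because  a² ≤ (R + a / 2) · 2K′ = K′ (a + 2R).
correction-≤ : ∀ a K′ R → 0 ℕ.< K′ → a ℕ.* a ℕ.≤ K′ ℕ.* (a ℕ.+ 2 ℕ.* R) → correction a K′ ℤ.≤ ℤ.+ R
correction-≤ a K′ R 0<K′ a²≤ = ℤₚ.⊔-lub (ℤ.+≤+ z≤n) (ceiling-≤ _ (ℤ.+ R) a²/2K′-a/2≤R)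
  where
  2K′ a/2 : ℚ
  2K′ = ℕ→ℚ (2 ℕ.* K′)
  a/2 = ℚ._/_ (ℤ.+ a) 2
  2K′≢0 : 2K′ ≢ 0ℚ
  2K′≢0 = ℕ→ℚ-≢0 (2 ℕ.* K′) (ℕₚ.≤-trans 0<K′ (ℕₚ.m≤m+n K′ (K′ ℕ.+ 0)))
  instance
    2K′-nonZero : ℚ.NonZero 2K′
    2K′-nonZero = ℚ.≢-nonZero 2K′≢0
  2K′>0 : ℚ.Positive 2K′
  2K′>0 = ℚₚ.nonNeg∧nonZero⇒pos 2K′ {{ℚ.nonNegative (ℤ→ℚ-mono-≤ {ℤ.+ 0} {ℤ.+ (2 ℕ.* K′)} (ℤ.+≤+ z≤n))}}
  identity : ∀ r a k → ((r ℤ.* ℤ.+ 2 ℤ.+ a ℤ.* ℤ.+ 1) ℤ.* (ℤ.+ 2 ℤ.* k)) ℤ.* ℤ.+ 1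
      ≡ (k ℤ.* (a ℤ.+ ℤ.+ 2 ℤ.* r)) ℤ.* ℤ.+ 2
  identity = ℤ-Solver.solve-∀
  [R+a/2]2K′ : (ℤ→ℚ (ℤ.+ R) ℚ.+ a/2) ℚ.* 2K′ ≡ ℕ→ℚ (K′ ℕ.* (a ℕ.+ 2 ℕ.* R))
  [R+a/2]2K′ = ℚₚ.toℚᵘ-injective (begin
    toℚᵘ ((ℤ→ℚ (ℤ.+ R) ℚ.+ a/2) ℚ.* 2K′)
      ≈⟨ ℚₚ.toℚᵘ-homo-* (ℤ→ℚ (ℤ.+ R) ℚ.+ a/2) 2K′ ⟩
    toℚᵘ (ℤ→ℚ (ℤ.+ R) ℚ.+ a/2) ℚᵘ.* toℚᵘ 2K′
      ≈⟨ ℚᵘₚ.*-cong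
          (ℚᵘₚ.≃-trans (ℚₚ.toℚᵘ-homo-+ (ℤ→ℚ (ℤ.+ R)) a/2)
              (ℚᵘₚ.+-cong (toℚᵘ-ℤ→ℚ (ℤ.+ R)) (ℚₚ.toℚᵘ-fromℚᵘ (mkℚᵘ (ℤ.+ a) 1)))) (toℚᵘ-ℤ→ℚ (ℤ.+ (2 ℕ.* K′))) ⟩
    (mkℚᵘ (ℤ.+ R) 0 ℚᵘ.+ mkℚᵘ (ℤ.+ a) 1) ℚᵘ.* mkℚᵘ (ℤ.+ (2 ℕ.* K′)) 0
      ≈⟨ ℚᵘ.*≡* (trans (cong (λ t → ((ℤ.+ R ℤ.* ℤ.+ 2 ℤ.+ ℤ.+ a ℤ.* ℤ.+ 1) ℤ.* t) ℤ.* ℤ.+ 1) (ℤₚ.pos-* 2 K′))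
                  (trans (identity (ℤ.+ R) (ℤ.+ a) (ℤ.+ K′))
                    (cong (ℤ._* ℤ.+ 2)
                        (sym (trans (ℤₚ.pos-* K′ (a ℕ.+ 2 ℕ.* R))
                            (cong (ℤ._*_ (ℤ.+ K′))
                                (trans (ℤₚ.pos-+ a (2 ℕ.* R)) (cong (ℤ._+_ (ℤ.+ a)) (ℤₚ.pos-* 2 R))))))))) ⟩
    mkℚᵘ (ℤ.+ (K′ ℕ.* (a ℕ.+ 2 ℕ.* R))) 0
      ≈⟨ toℚᵘ-ℤ→ℚ (ℤ.+ (K′ ℕ.* (a ℕ.+ 2 ℕ.* R))) ⟨
    toℚᵘ (ℕ→ℚ (K′ ℕ.* (a ℕ.+ 2 ℕ.* R))) ∎)
    where open ℚᵘₚ.≃-Reasoning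
  a²≤[R+a/2]2K′ : ℕ→ℚ (a ^ 2) ℚ.≤ (ℤ→ℚ (ℤ.+ R) ℚ.+ a/2) ℚ.* 2K′
  a²≤[R+a/2]2K′ = subst (ℕ→ℚ (a ^ 2) ℚ.≤_) (sym [R+a/2]2K′)
    (ℤ→ℚ-mono-≤ (ℤ.+≤+ (subst (ℕ._≤ K′ ℕ.* (a ℕ.+ 2 ℕ.* R)) (cong (a ℕ.*_) (sym (ℕₚ.*-identityʳ a))) a²≤)))
  a²/2K′-a/2≤R : (ℕ→ℚ (a ^ 2) ÷₀ 2K′) ℚ.- a/2 ℚ.≤ ℤ→ℚ (ℤ.+ R)
  a²/2K′-a/2≤R = begin
    (ℕ→ℚ (a ^ 2) ÷₀ 2K′) ℚ.- a/2   ≡⟨ cong (ℚ._- a/2) (÷₀≡÷ _ _ 2K′≢0) ⟩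
    (ℕ→ℚ (a ^ 2) ℚ.÷ 2K′) ℚ.- a/2
      ≤⟨ ℚₚ.+-monoˡ-≤ (ℚ.- a/2) (÷-≤ (ℕ→ℚ (a ^ 2)) 2K′ (ℤ→ℚ (ℤ.+ R) ℚ.+ a/2) {{_}} {{2K′>0}} a²≤[R+a/2]2K′) ⟩
    (ℤ→ℚ (ℤ.+ R) ℚ.+ a/2) ℚ.- a/2
      ≡⟨ trans (ℚₚ.+-assoc (ℤ→ℚ (ℤ.+ R)) a/2 (ℚ.- a/2))
          (trans (cong (ℤ→ℚ (ℤ.+ R) ℚ.+_) (ℚₚ.+-inverseʳ a/2)) (ℚₚ.+-identityʳ _)) ⟩
    ℤ→ℚ (ℤ.+ R)                    ∎
    where open ℚₚ.≤-Reasoning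

denominator-identity : ∀ σ K S R a (M : ℤ) → σ ℕ.+ K ≡ (S ℕ.+ 2 ℕ.* R) ℕ.+ 3 ℕ.* a →
  ℤ.+ σ ℤ.- ℤ.+ (3 ℕ.* a) ℤ.+ ℤ.+ K ℤ.- ℤ.+ 2 ℤ.* M ≡ ℤ.+ S ℤ.+ ((ℤ.+ R ℤ.- M) ℤ.+ (ℤ.+ R ℤ.- M))
denominator-identity σ K S R a M σ+K≡ = begin
  ℤ.+ σ ℤ.- ℤ.+ (3 ℕ.* a) ℤ.+ ℤ.+ K ℤ.- ℤ.+ 2 ℤ.* M
    ≡⟨ cong (λ t → ℤ.+ σ ℤ.- t ℤ.+ ℤ.+ K ℤ.- ℤ.+ 2 ℤ.* M) (ℤₚ.pos-* 3 a) ⟩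
  ℤ.+ σ ℤ.- ℤ.+ 3 ℤ.* ℤ.+ a ℤ.+ ℤ.+ K ℤ.- ℤ.+ 2 ℤ.* M
    ≡⟨ regroup (ℤ.+ σ) (ℤ.+ K) (ℤ.+ a) M ⟩
  (ℤ.+ σ ℤ.+ ℤ.+ K) ℤ.- ℤ.+ 3 ℤ.* ℤ.+ a ℤ.- ℤ.+ 2 ℤ.* M
    ≡⟨ cong (λ t → t ℤ.- ℤ.+ 3 ℤ.* ℤ.+ a ℤ.- ℤ.+ 2 ℤ.* M) σ+K≡ᶻ ⟩
  (ℤ.+ S ℤ.+ ℤ.+ 2 ℤ.* ℤ.+ R ℤ.+ ℤ.+ 3 ℤ.* ℤ.+ a) ℤ.- ℤ.+ 3 ℤ.* ℤ.+ a ℤ.- ℤ.+ 2 ℤ.* M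
    ≡⟨ cancel (ℤ.+ S) (ℤ.+ R) (ℤ.+ a) M ⟩
  ℤ.+ S ℤ.+ ((ℤ.+ R ℤ.- M) ℤ.+ (ℤ.+ R ℤ.- M)) ∎
  where
  open ≡-Reasoning
  σ+K≡ᶻ : ℤ.+ σ ℤ.+ ℤ.+ K ≡ ℤ.+ S ℤ.+ ℤ.+ 2 ℤ.* ℤ.+ R ℤ.+ ℤ.+ 3 ℤ.* ℤ.+ a
  σ+K≡ᶻ = trans (sym (ℤₚ.pos-+ σ K)) (trans (cong ℤ.+_ σ+K≡)
            (trans (ℤₚ.pos-+ (S ℕ.+ 2 ℕ.* R) (3 ℕ.* a))
              (cong₂ ℤ._+_ (trans (ℤₚ.pos-+ S (2 ℕ.* R)) (cong (ℤ._+_ (ℤ.+ S)) (ℤₚ.pos-* 2 R)))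
                  (ℤₚ.pos-* 3 a))))
  regroup : ∀ σ K a m → σ ℤ.- ℤ.+ 3 ℤ.* a ℤ.+ K ℤ.- ℤ.+ 2 ℤ.* m ≡ (σ ℤ.+ K) ℤ.- ℤ.+ 3 ℤ.* a ℤ.- ℤ.+ 2 ℤ.* m
  regroup = ℤ-Solver.solve-∀
  cancel : ∀ s r a m → (s ℤ.+ ℤ.+ 2 ℤ.* r ℤ.+ ℤ.+ 3 ℤ.* a) ℤ.- ℤ.+ 3 ℤ.* a ℤ.- ℤ.+ 2 ℤ.* m
      ≡ s ℤ.+ ((r ℤ.- m) ℤ.+ (r ℤ.- m))
  cancel = ℤ-Solver.solve-∀

module _ {n k h a σ} (counts : EdgeCountData n k h a σ) where
  open EdgeCountData counts

  private
    K K′ : ℕ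
    K  = (k ∸ 1) ^ h
    K′ = (k ∸ 1) ^ (h ∸ 1)
    M Dᶻ : ℤ
    M  = correction a K′
    Dᶻ = ℤ.+ squareCount ℤ.+ ((ℤ.+ pairCount ℤ.- M) ℤ.+ (ℤ.+ pairCount ℤ.- M))

  denominator≡squares+2[pairs-M] : denominator k h a σ ≡ ℤ→ℚ Dᶻ
  denominator≡squares+2[pairs-M] = sym
      (trans (cong ℤ→ℚ (sym (denominator-identity σ K squareCount pairCount a M σ+K≡)))
    (trans (ℤ→ℚ-- (ℤ.+ σ ℤ.- ℤ.+ (3 ℕ.* a) ℤ.+ ℤ.+ K) (ℤ.+ 2 ℤ.* M))
      (cong (ℚ._- ℤ→ℚ (ℤ.+ 2 ℤ.* M))
          (trans (ℤ→ℚ-+ (ℤ.+ σ ℤ.- ℤ.+ (3 ℕ.* a)) (ℤ.+ K))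
              (cong (ℚ._+ ℕ→ℚ K) (ℤ→ℚ-- (ℤ.+ σ) (ℤ.+ (3 ℕ.* a))))))))
    where
    σ+K≡ : σ ℕ.+ K ≡ (squareCount ℕ.+ 2 ℕ.* pairCount) ℕ.+ 3 ℕ.* a
    σ+K≡ = trans (ℕₚ.+-comm σ K) (trans (sym balance) (regroup squareCount a pairCount))
      where
      regroup : ∀ s a r → s ℕ.+ (a ℕ.+ 2 ℕ.* r) ℕ.+ (a ℕ.+ a) ≡ (s ℕ.+ 2 ℕ.* r) ℕ.+ 3 ℕ.* a
      regroup = solve-∀

  numerator≡walks² : numerator k h a ≡ ℤ→ℚ (ℤ.+ (walkCount ℕ.* walkCount))
  numerator≡walks² = sym
      (trans (cong ℤ→ℚ (ℤₚ.pos-* walkCount walkCount))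
          (trans (ℤ→ℚ-* (ℤ.+ walkCount) (ℤ.+ walkCount)) (cong₂ ℚ._*_ walks≡ walks≡)))
    where
    walks≡ : ℕ→ℚ walkCount ≡ ℕ→ℚ K ℚ.- ℕ→ℚ a
    walks≡ = sym (trans (cong (λ t → ℕ→ℚ t ℚ.- ℕ→ℚ a) walks-split) (ℕ→ℚ-m+n-m a walkCount))

  -- D = S + 2 (R - M) ≥ S, and N = P² ≤ X S by Cauchy–Schwarz.
  ceiling-quotient≤freshCount : 0 ℕ.< K′ → ceiling (numerator k h a ÷₀ denominator k h a σ) ℤ.≤ ℤ.+ freshCount
  ceiling-quotient≤freshCount 0<K′ = subst (λ q → ceiling q ℤ.≤ ℤ.+ freshCount)
      (sym (cong₂ _÷₀_ numerator≡walks² denominator≡squares+2[pairs-M]))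
    (ceiling-÷₀-≤ (ℤ.+ (walkCount ℕ.* walkCount)) Dᶻ (ℤ.+ freshCount) (ℤₚ.≤-trans (ℤ.+≤+ z≤n) S≤Dᶻ)
      (ℤₚ.≤-trans (ℤ.+≤+ walks-cauchy-schwarz)
          (subst (ℤ._≤ ℤ.+ freshCount ℤ.* Dᶻ) (sym (ℤₚ.pos-* freshCount squareCount))
              (ℤₚ.*-monoˡ-≤-nonNeg (ℤ.+ freshCount) S≤Dᶻ)))
      (ℤ.+≤+ z≤n))
    where
    pairs-M≥0 : ℤ.0ℤ ℤ.≤ ℤ.+ pairCount ℤ.- M
    pairs-M≥0 = ℤₚ.i≤j⇒0≤j-i (correction-≤ a K′ pairCount 0<K′ cycles-cauchy-schwarz)
    S≤Dᶻ : ℤ.+ squareCount ℤ.≤ Dᶻ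
    S≤Dᶻ = ℤₚ.i≤i+j (ℤ.+ squareCount) _ {{ℤ.nonNegative (ℤₚ.+-mono-≤ pairs-M≥0 pairs-M≥0)}}

order-bound : ∀ {n k h a σ} → 3 ℕ.≤ k → EdgeCountData n k h a σ →
  ℕ→ℚ (2 ℕ.* ((k ∸ 1) ^ h ∸ 1)) ÷₀ ℕ→ℚ (k ∸ 2) ℚ.+ ℤ→ℚ
      (ceiling (numerator k h a ÷₀ denominator k h a σ)) ℚ.≤ ℕ→ℚ n
order-bound {k = suc zero} (s≤s ()) _
order-bound {k = suc (suc zero)} (s≤s (s≤s ())) _
order-bound {k = suc (suc (suc k′))} {h} {a} {σ} 3≤k counts = begin
  ℕ→ℚ (2 ℕ.* (suc (suc k′) ^ h ∸ 1)) ÷₀ ℕ→ℚ (suc k′) ℚ.+ ℤ→ℚ quotient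
    ≡⟨ cong (ℚ._+ ℤ→ℚ quotient)
        (moore-term (suc (suc (suc k′))) (suc (suc k′) ^ h) T 3≤k (moore-identity (suc k′) h)) ⟩
  ℕ→ℚ T ℚ.+ ℤ→ℚ quotient
    ≤⟨ ℚₚ.+-monoʳ-≤ (ℕ→ℚ T)
        (ℤ→ℚ-mono-≤ (ceiling-quotient≤freshCount counts (ℕₚ.m^n>0 (suc (suc k′)) (h ∸ 1)))) ⟩
  ℕ→ℚ T ℚ.+ ℕ→ℚ freshCount
    ≡⟨ ℕ→ℚ-+ T freshCount ⟨
  ℕ→ℚ (T ℕ.+ freshCount)
    ≤⟨ ℕ→ℚ-mono-≤ order ⟩
  _ ∎
  where
  open EdgeCountData counts
  open ℚₚ.≤-Reasoning
  quotient : ℤ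
  quotient = ceiling (numerator (suc (suc (suc k′))) h a ÷₀ denominator (suc (suc (suc k′))) h a σ)
  T : ℕ
  T = 2 ℕ.* ∑[ j < h ] (suc (suc k′) ^ toℕ j)

module _ {n : ℕ} (G : Graph n) {g k : ℕ} {a : Vec ℕ k}
    (signature : ∀ u → edgeCycleCounts G g u ↭ toList a) where

  signature-edge : ∀ u i → Σ (Fin n) λ v → adj G u v ≡ true × lookup a i ≡ cyclesThroughEdge G g u v
  signature-edge u i with v , v∈ , aᵢ≡ ← ∈-map⁻ (cyclesThroughEdge G g u)
      (∈-resp-↭ (↭-sym (signature u)) (∈-toList⁺ (∈-lookup i a))) =
    v , Equivalence.to Boolₚ.T-≡
        (proj₂ (∈-filter⁻ (λ w → T? (adj G u w)) {xs = vertices n} v∈)) , aᵢ≡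

  signature-sum : ∀ u → sum (toList a) ≡ ∑[ w < n ] (⟦ adj G u w ⟧ * cyclesThroughEdge G g u w)
  signature-sum u = trans (sym (sum-↭ (signature u)))
      (sum-map-filterᵇ-vertices (adj G u) (cyclesThroughEdge G g u))

theorem4p4 : (n k h : ℕ) → 3 ≤ k → (G : Graph n) → Connected G → Regular G k
    → HasGirth G (2 ℕ.* h) → (a : Vec ℕ k) → GirthRegularWithSignature G (2 ℕ.* h) k a
    → (i : Fin k)
    → let ai = lookup a i
          K  = (k ∸ 1) ^ h
          K′ = (k ∸ 1) ^ (h ∸ 1)
          M  = ℤ.0ℤ ℤ.⊔ ceiling ((ℕ→ℚ (ai ^ 2) ÷₀ ℕ→ℚ (2 ℕ.* K′)) ℚ.- (ℚ._/_ (ℤ.+ ai) 2))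
          D  = ℕ→ℚ (sum (toList a)) ℚ.- ℕ→ℚ (3 ℕ.* ai) ℚ.+ ℕ→ℚ K ℚ.- ℤ→ℚ (ℤ.+ 2 ℤ.* M)
          N  = (ℕ→ℚ K ℚ.- ℕ→ℚ ai) ℚ.* (ℕ→ℚ K ℚ.- ℕ→ℚ ai)
      in (ℕ→ℚ (2 ℕ.* (K ∸ 1)) ÷₀ ℕ→ℚ (k ∸ 2)) ℚ.+ ℤ→ℚ (ceiling (N ÷₀ D)) ℚ.≤ ℕ→ℚ n
theorem4p4 n k zero 3≤k G _ regular ((Vec.[] , ()) , _) a _ i
theorem4p4 n k (suc zero) 3≤k G _ regular ((_ Vec.∷ _ Vec.∷ Vec.[] , ()) , _) a _ i
theorem4p4 n k h@(suc (suc m)) 3≤k G _ regular ((u Vec.∷ _ , _) , noShortCycle) a (_ , signature) i =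
  order-bound 3≤k (subst₂ (EdgeCountData n k h) (sym aᵢ≡) (sym σ≡) edgeCountData)
  where
  open NonBacktracking G using (nbWalks)
  2h≡h+h : 2 ℕ.* h ≡ h + h
  2h≡h+h = cong (h +_) (ℕₚ.+-identityʳ h)
  noShortCycle′ : ∀ ℓ → ℓ < h + h → ¬ HasCycleOfLength G ℓ
  noShortCycle′ ℓ ℓ<2h = noShortCycle ℓ (subst (ℓ <_) (sym 2h≡h+h) ℓ<2h)
  cycles≡ : ∀ w → cyclesThroughEdge G (2 ℕ.* h) u w ≡ nbWalks (h + h) u w u w
  cycles≡ w = trans (cong (λ ℓ → cyclesThroughEdge G ℓ u w) 2h≡h+h)
                    (ShortCycles.cyclesThroughEdge≡nbWalks G (h + h) noShortCycle′ (h + h) u w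
                        (s≤s (s≤s (ℕₚ.≤-trans (s≤s z≤n) (ℕₚ.m≤n+m (suc (suc m)) m)))) ℕₚ.≤-refl)
  edge : Σ (Fin n) λ v → adj G u v ≡ true × lookup a i ≡ cyclesThroughEdge G (2 ℕ.* h) u v
  edge = signature-edge G {g = 2 ℕ.* h} signature u i
  v : Fin n
  v = proj₁ edge
  open EdgeCounts G regular m noShortCycle′ (proj₁ (proj₂ edge)) using
      (edgeCountData; signatureSum)
  aᵢ≡ : lookup a i ≡ nbWalks (h + h) u v u v
  aᵢ≡ = trans (proj₂ (proj₂ edge)) (cycles≡ v)
  σ≡ : sum (toList a) ≡ signatureSum
  σ≡ = trans (signature-sum G {g = 2 ℕ.* h} signature u) (∑-cong λ w → cong (⟦ adj G u w ⟧ *_) (cycles≡ w))
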